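{- Let $G = \sum_{n=0}^\infty \frac{(-1)^n}{(2n+1)^2}$ denote Catalan's constant. Then $$G = \frac12 \sum_{n=0}^\infty (-1)^n \, \frac{(3n+2)\, 8^n}{(2n+1)^3 \binom{2n}{n}^3}.$$
   Context: $\binom{2n}{n}$ denotes the central binomial coefficient. -}

module Defs where

open import Data.Nat as ℕ using (ℕ; zero; suc)
open import Data.Nat.Combinatorics using (_C_)
open import Data.Integer as ℤ using (ℤ; +_)
open import Data.Rational using (ℚ; 0ℚ; _+_; _/_)

-- Total division of an integer by a natural number; the zero-denominator
-- clause is a convention only and is never used below, since every
-- denominator occurring here is positive ((2n+1)^k > 0 and (2n choose n) > 0).
_/′_ : ℤ → ℕ → ℚ
z /′ zero  = 0ℚ
z /′ suc d = z / suc d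

sgn : ℕ → ℤ
sgn zero    = ℤ.1ℤ
sgn (suc n) = ℤ.- sgn n

central : ℕ → ℕ
central n = (2 ℕ.* n) C n

catalanTerm : ℕ → ℚ
catalanTerm n = sgn n /′ ((2 ℕ.* n ℕ.+ 1) ℕ.^ 2)

rhsTerm : ℕ → ℚ
rhsTerm n = (sgn n ℤ.* (+ ((3 ℕ.* n ℕ.+ 2) ℕ.* 8 ℕ.^ n)))
            /′ (2 ℕ.* ((2 ℕ.* n ℕ.+ 1) ℕ.^ 3 ℕ.* central n ℕ.^ 3))

partial : (ℕ → ℚ) → ℕ → ℚ
partial f zero    = 0ℚ
partial f (suc N) = partial f N + f N

-- Two WZ pairs (F, G), i.e. F(n,k+1) − F(n,k) = G(n+1,k) − G(n,k), do the work. Summing the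
-- first over a rectangle trades the Catalan partial sums (its G-boundary) for the partial sums of
-- an auxiliary series Σ P(k) with P(k) = 4ᵏ k!² / ((2k+1)! (2k+1)) (its F-boundary); summing the
-- second trades Σ P(k) for the right-hand partial sums. Eliminating Σ P(k) writes 4 (Cₙ − Rₙ)
-- exactly as a combination of four edge sums, which give 4 |Cₙ₊₁ − Rₙ₊₁| ≤ 20 wₘ + 10/(n+1) for
-- every m, where wₘ = ∏_{j<m} (2j+2)/(2j+3) satisfies wₘ² ≤ 1/(m+1); so Cₙ − Rₙ → 0. The Catalan partial sums
-- are Cauchy because |(−1)ᵏ/(2k+1)²| ≤ 2/(k+1) − 2/(k+2), and then so are the right-hand ones.

module Submission where

open import Agda.Builtin.FromNat
open import Data.Empty using (⊥-elim)
open import Data.Integer as ℤ using (ℤ; +_; -[1+_])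
import Data.Integer.Properties as ℤ
open import Data.Maybe.Base using (just; nothing)
open import Data.Nat as ℕ using (ℕ; zero; suc; _!; _≥_)
import Data.Nat.Literals as ℕ-Literals
import Data.Nat.Properties as ℕ
open import Data.Nat.Combinatorics using (nCk≡n!/k![n-k]!; k![n∸k]!∣n!)
open import Data.Nat.DivMod using (m/n*n≡m)
open import Data.Product using (Σ; _×_; _,_; proj₁; proj₂)
open import Data.Rational hiding (_≥_)
import Data.Rational.Literals as ℚ-Literals
open import Data.Rational.Properties
import Data.Rational.Unnormalised as ℚᵘ
import Data.Rational.Unnormalised.Properties as ℚᵘ
open import Data.Sum using ([_,_]′)
open import Data.Unit.Base using (tt)
open import Level using (0ℓ)
open import Relation.Binary.PropositionalEquality using (_≡_; _≢_; refl; sym; trans; cong; cong₂; subst; subst₂; module ≡-Reasoning)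
open import Relation.Nullary using (yes; no)
import Tactic.RingSolver.Core.AlmostCommutativeRing as ACR
open import Tactic.RingSolver using (solve-∀)

open import Defs

instance
  ℕ-number : Number ℕ
  ℕ-number = ℕ-Literals.number

  ℚ-number : Number ℚ
  ℚ-number = ℚ-Literals.number

ℚ-ring : ACR.AlmostCommutativeRing 0ℓ 0ℓ
ℚ-ring = ACR.fromCommutativeRing +-*-commutativeRing isZero
  where
  isZero : ∀ x → _
  isZero x with x ≟ 0ℚ
  ... | yes x≡0 = just (sym x≡0)
  ... | no _    = nothing

+-nonNeg : ∀ {x y} → 0ℚ ≤ x → 0ℚ ≤ y → 0ℚ ≤ x + y
+-nonNeg = +-mono-≤

*-nonNeg : ∀ {x y} → 0ℚ ≤ x → 0ℚ ≤ y → 0ℚ ≤ x * y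
*-nonNeg {x} {y} 0≤x 0≤y =
  nonNegative⁻¹ (x * y) {{nonNeg*nonNeg⇒nonNeg x {{nonNegative 0≤x}} y {{nonNegative 0≤y}}}}

*-pos : ∀ {x y} → 0ℚ < x → 0ℚ < y → 0ℚ < x * y
*-pos {x} {y} 0<x 0<y = positive⁻¹ (x * y) {{pos*pos⇒pos x {{positive 0<x}} y {{positive 0<y}}}}

*-monoˡ-≤ : ∀ {a b} c → 0ℚ ≤ c → a ≤ b → c * a ≤ c * b
*-monoˡ-≤ c 0≤c = *-monoˡ-≤-nonNeg c {{nonNegative 0≤c}}

*-monoʳ-≤ : ∀ {a b} c → 0ℚ ≤ c → a ≤ b → a * c ≤ b * c
*-monoʳ-≤ c 0≤c = *-monoʳ-≤-nonNeg c {{nonNegative 0≤c}}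

*-mono-≤ : ∀ {a b c d} → 0ℚ ≤ a → 0ℚ ≤ c → a ≤ b → c ≤ d → a * c ≤ b * d
*-mono-≤ {a} {b} {c} 0≤a 0≤c a≤b c≤d =
  ≤-trans (*-monoʳ-≤ c 0≤c a≤b) (*-monoˡ-≤ b (≤-trans 0≤a a≤b) c≤d)

≤-from-slack : ∀ {x y} s → 0ℚ ≤ s → y ≡ x + s → x ≤ y
≤-from-slack {x} {y} s 0≤s y≡x+s = begin
  x       ≡⟨ +-identityʳ x ⟨
  x + 0ℚ  ≤⟨ +-monoʳ-≤ x 0≤s ⟩
  x + s   ≡⟨ y≡x+s ⟨
  y       ∎
  where open ≤-Reasoning

x-y≤x : ∀ {x y} → 0ℚ ≤ y → x - y ≤ x
x-y≤x {x} {y} 0≤y = ≤-from-slack y 0≤y (x≡x-y+y x y)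
  where
  x≡x-y+y : ∀ x y → x ≡ x - y + y
  x≡x-y+y = solve-∀ ℚ-ring

pos⇒≢0 : ∀ {x} → 0ℚ < x → x ≢ 0ℚ
pos⇒≢0 0<x x≡0 = <-irrefl (sym x≡0) 0<x

fromℕ : ℕ → ℚ
fromℕ zero    = 0ℚ
fromℕ (suc n) = 1ℚ + fromℕ n

fromℕ-+ : ∀ m n → fromℕ (m ℕ.+ n) ≡ fromℕ m + fromℕ n
fromℕ-+ zero    n = sym (+-identityˡ (fromℕ n))
fromℕ-+ (suc m) n = trans (cong (λ x → 1ℚ + x) (fromℕ-+ m n)) (sym (+-assoc 1ℚ (fromℕ m) (fromℕ n)))

fromℕ-* : ∀ m n → fromℕ (m ℕ.* n) ≡ fromℕ m * fromℕ n
fromℕ-* zero    n = sym (*-zeroˡ (fromℕ n))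
fromℕ-* (suc m) n = begin
  fromℕ (n ℕ.+ m ℕ.* n)          ≡⟨ fromℕ-+ n (m ℕ.* n) ⟩
  fromℕ n + fromℕ (m ℕ.* n)      ≡⟨ cong (λ x → fromℕ n + x) (fromℕ-* m n) ⟩
  fromℕ n + fromℕ m * fromℕ n    ≡⟨ suc-distrib (fromℕ m) (fromℕ n) ⟩
  (1ℚ + fromℕ m) * fromℕ n       ∎
  where
  open ≡-Reasoning
  suc-distrib : ∀ a b → b + a * b ≡ (1ℚ + a) * b
  suc-distrib = solve-∀ ℚ-ring

fromℕ-nonNeg : ∀ n → 0ℚ ≤ fromℕ n
fromℕ-nonNeg zero    = ≤-refl
fromℕ-nonNeg (suc n) = +-nonNeg (nonNegative⁻¹ 1ℚ) (fromℕ-nonNeg n)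

fromℕ-mono-≤ : ∀ {m n} → m ℕ.≤ n → fromℕ m ≤ fromℕ n
fromℕ-mono-≤ {m} {n} m≤n = ≤-from-slack (fromℕ (n ℕ.∸ m)) (fromℕ-nonNeg (n ℕ.∸ m))
  (trans (cong fromℕ (sym (ℕ.m+[n∸m]≡n m≤n))) (fromℕ-+ m (n ℕ.∸ m)))

nonNeg+pos : ∀ {x c} → 0ℚ ≤ x → 0ℚ < c → 0ℚ < x + c
nonNeg+pos {x} {c} 0≤x 0<c = begin-strict
  0ℚ       ≡⟨ +-identityˡ 0ℚ ⟨
  0ℚ + 0ℚ  <⟨ +-mono-≤-< 0≤x 0<c ⟩
  x + c    ∎
  where open ≤-Reasoning

-- A total reciprocal; the junk value inv 0ℚ = 0ℚ never occurs, as inv is only applied to positive numbers.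

inv : ℚ → ℚ
inv x with x ≟ 0ℚ
... | yes _   = 0ℚ
... | no x≢0 = 1/_ x {{≢-nonZero x≢0}}

inv-inverseʳ : ∀ {x} → x ≢ 0ℚ → x * inv x ≡ 1ℚ
inv-inverseʳ {x} x≢0 with x ≟ 0ℚ
... | yes x≡0 = ⊥-elim (x≢0 x≡0)
... | no x≢0′ = *-inverseʳ x {{≢-nonZero x≢0′}}

inv-pos : ∀ {x} → 0ℚ < x → 0ℚ < inv x
inv-pos {x} 0<x with x ≟ 0ℚ
... | yes x≡0 = ⊥-elim (pos⇒≢0 0<x x≡0)
... | no x≢0 = positive⁻¹ _ {{1/pos⇒pos x {{positive 0<x}}}}

*-cancelʳ-≡ : ∀ {x y} D → D ≢ 0ℚ → x * D ≡ y * D → x ≡ y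
*-cancelʳ-≡ {x} {y} D D≢0 xD≡yD = begin
  x                ≡⟨ cancel x ⟨
  x * D * inv D    ≡⟨ cong (_* inv D) xD≡yD ⟩
  y * D * inv D    ≡⟨ cancel y ⟩
  y                ∎
  where
  open ≡-Reasoning
  cancel : ∀ z → z * D * inv D ≡ z
  cancel z = trans (*-assoc z D (inv D)) (trans (cong (z *_) (inv-inverseʳ D≢0)) (*-identityʳ z))

inv-antitone : ∀ {x y} → 0ℚ < x → x ≤ y → inv y ≤ inv x
inv-antitone {x} {y} 0<x x≤y = *-cancelʳ-≤-pos (x * y) {{positive (*-pos 0<x 0<y)}} (begin
  inv y * (x * y)        ≡⟨ rearrange (inv y) x y ⟩
  x * (y * inv y)        ≡⟨ cong (x *_) (inv-inverseʳ (pos⇒≢0 0<y)) ⟩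
  x * 1ℚ                 ≤⟨ *-monoʳ-≤ 1ℚ (nonNegative⁻¹ 1ℚ) x≤y ⟩
  y * 1ℚ                 ≡⟨ cong (y *_) (inv-inverseʳ (pos⇒≢0 0<x)) ⟨
  y * (x * inv x)        ≡⟨ rearrange (inv x) y x ⟨
  inv x * (y * x)        ≡⟨ cong (inv x *_) (*-comm y x) ⟩
  inv x * (x * y)        ∎)
  where
  open ≤-Reasoning
  0<y : 0ℚ < y
  0<y = <-≤-trans 0<x x≤y
  rearrange : ∀ a b c → a * (b * c) ≡ b * (c * a)
  rearrange = solve-∀ ℚ-ring

-- Clearing denominators: after multiplying by D, each product of a denominator with its
-- reciprocal is an atom (a, b, c) equal to 1, and what remains is a polynomial claim.

≡-by-clearing : ∀ {L R} D → D ≢ 0ℚ → (FL FR : ℚ → ℚ → ℚ) → ∀ {a b} → a ≡ 1ℚ → b ≡ 1ℚ →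
                L * D ≡ FL a b → R * D ≡ FR a b → FL 1ℚ 1ℚ ≡ FR 1ℚ 1ℚ → L ≡ R
≡-by-clearing D D≢0 FL FR refl refl LD≡ RD≡ eq = *-cancelʳ-≡ D D≢0 (trans LD≡ (trans eq (sym RD≡)))

≤-by-clearing : ∀ {L R} D → 0ℚ < D → (FL FR : ℚ → ℚ → ℚ → ℚ) → ∀ {a b c} → a ≡ 1ℚ → b ≡ 1ℚ → c ≡ 1ℚ →
                L * D ≡ FL a b c → R * D ≡ FR a b c → FL 1ℚ 1ℚ 1ℚ ≤ FR 1ℚ 1ℚ 1ℚ → L ≤ R
≤-by-clearing D 0<D FL FR refl refl refl LD≡ RD≡ le =
  *-cancelʳ-≤-pos D {{positive 0<D}} (subst₂ _≤_ (sym LD≡) (sym RD≡) le)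

partial-cong : ∀ {f g} → (∀ n → f n ≡ g n) → ∀ N → partial f N ≡ partial g N
partial-cong f≡g zero    = refl
partial-cong f≡g (suc N) = cong₂ _+_ (partial-cong f≡g N) (f≡g N)

partial-scale : ∀ c (f : ℕ → ℚ) N → partial (λ n → c * f n) N ≡ c * partial f N
partial-scale c f zero    = sym (*-zeroʳ c)
partial-scale c f (suc N) = trans (cong (_+ c * f N) (partial-scale c f N))
                                  (sym (*-distribˡ-+ c (partial f N) (f N)))

partial-sub : ∀ (f g : ℕ → ℚ) N → partial (λ n → f n - g n) N ≡ partial f N - partial g N
partial-sub f g zero    = refl
partial-sub f g (suc N) = trans (cong (_+ (f N - g N)) (partial-sub f g N))
                                (interchange (partial f N) (partial g N) (f N) (g N))
  where
  interchange : ∀ p q a b → (p - q) + (a - b) ≡ (p + a) - (q + b)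
  interchange = solve-∀ ℚ-ring

partial-telescope : ∀ (h : ℕ → ℚ) N → partial (λ n → h (suc n) - h n) N ≡ h N - h 0
partial-telescope h zero    = sym (+-inverseʳ (h 0))
partial-telescope h (suc N) = trans (cong (_+ (h (suc N) - h N)) (partial-telescope h N))
                                    (chain (h N) (h (suc N)) (h 0))
  where
  chain : ∀ a b c → (a - c) + (b - a) ≡ b - c
  chain = solve-∀ ℚ-ring

partial-shift : ∀ (f : ℕ → ℚ) n d → partial f (d ℕ.+ n) - partial f n ≡ partial (λ k → f (k ℕ.+ n)) d
partial-shift f n zero    = +-inverseʳ (partial f n)
partial-shift f n (suc d) = trans (regroup (partial f (d ℕ.+ n)) (partial f n) (f (d ℕ.+ n)))
                                  (cong (_+ f (d ℕ.+ n)) (partial-shift f n d))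
  where
  regroup : ∀ a b x → (a + x) - b ≡ (a - b) + x
  regroup = solve-∀ ℚ-ring

partial-mono-≤ : ∀ {f g} → (∀ k → f k ≤ g k) → ∀ n → partial f n ≤ partial g n
partial-mono-≤ f≤g zero    = ≤-refl
partial-mono-≤ f≤g (suc n) = +-mono-≤ (partial-mono-≤ f≤g n) (f≤g n)

∣partial∣≤ : ∀ {f g} → (∀ k → ∣ f k ∣ ≤ g k) → ∀ n → ∣ partial f n ∣ ≤ partial g n
∣partial∣≤ f≤g zero    = ≤-refl
∣partial∣≤ {f} f≤g (suc n) =
  ≤-trans (∣p+q∣≤∣p∣+∣q∣ (partial f n) (f n)) (+-mono-≤ (∣partial∣≤ f≤g n) (f≤g n))

partial-≤-telescope : ∀ {f} (b : ℕ → ℚ) → (∀ k → f k ≤ b k - b (suc k)) → ∀ n → partial f n ≤ b 0 - b n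
partial-≤-telescope {f} b f≤Δb n = begin
  partial f n                                ≤⟨ partial-mono-≤ {g = Δb} f≤Δb n ⟩
  partial Δb n                               ≡⟨ partial-cong {g = λ k → - 1ℚ * (b (suc k) - b k)}
                                                             (λ k → flip (b k) (b (suc k))) n ⟩
  partial (λ k → - 1ℚ * (b (suc k) - b k)) n ≡⟨ partial-scale (- 1ℚ) (λ k → b (suc k) - b k) n ⟩
  - 1ℚ * partial (λ k → b (suc k) - b k) n   ≡⟨ cong (- 1ℚ *_) (partial-telescope b n) ⟩
  - 1ℚ * (b n - b 0)                         ≡⟨ flip (b 0) (b n) ⟨
  b 0 - b n                                  ∎
  where
  open ≤-Reasoning
  Δb : ℕ → ℚ
  Δb k = b k - b (suc k)
  flip : ∀ x y → x - y ≡ - 1ℚ * (y - x)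
  flip = solve-∀ ℚ-ring

partial≤ : ∀ {f} (b : ℕ → ℚ) → (∀ k → f k ≤ b k - b (suc k)) → (∀ k → 0ℚ ≤ b k) → ∀ n → partial f n ≤ b 0
partial≤ b f≤Δb 0≤b n = ≤-trans (partial-≤-telescope b f≤Δb n) (x-y≤x (0≤b n))

∣partial-tail∣≤ : ∀ {f} (b : ℕ → ℚ) → (∀ k → ∣ f k ∣ ≤ b k - b (suc k)) → (∀ k → 0ℚ ≤ b k) →
                  ∀ n d → ∣ partial f (d ℕ.+ n) - partial f n ∣ ≤ b n
∣partial-tail∣≤ {f} b ∣f∣≤Δb 0≤b n d = begin
  ∣ partial f (d ℕ.+ n) - partial f n ∣      ≡⟨ cong ∣_∣ (partial-shift f n d) ⟩
  ∣ partial (λ k → f (k ℕ.+ n)) d ∣          ≤⟨ ∣partial∣≤ {g = λ k → ∣ f (k ℕ.+ n) ∣} (λ k → ≤-refl) d ⟩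
  partial (λ k → ∣ f (k ℕ.+ n) ∣) d          ≤⟨ partial≤ (λ k → b (k ℕ.+ n)) (λ k → ∣f∣≤Δb (k ℕ.+ n)) (λ k → 0≤b (k ℕ.+ n)) d ⟩
  b n                                        ∎
  where open ≤-Reasoning

∣partial∣≤-scaled : ∀ {f g} c B → 0ℚ ≤ c → (∀ k → ∣ f k ∣ ≤ c * g k) → ∀ n → partial g n ≤ B → ∣ partial f n ∣ ≤ c * B
∣partial∣≤-scaled {f} {g} c B 0≤c ∣f∣≤cg n Σg≤B = begin
  ∣ partial f n ∣                 ≤⟨ ∣partial∣≤ ∣f∣≤cg n ⟩
  partial (λ k → c * g k) n       ≡⟨ partial-scale c g n ⟩
  c * partial g n                 ≤⟨ *-monoˡ-≤ c 0≤c Σg≤B ⟩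
  c * B                           ∎
  where open ≤-Reasoning

-- WZ pairs

IsWZPair : (F G : ℕ → ℕ → ℚ) → Set
IsWZPair F G = ∀ n k → F n (suc k) - F n k ≡ G (suc n) k - G n k

-- Summing the WZ equation over the rectangle [0, N) × [0, K) and telescoping in both directions.
wz-rectangle : ∀ {F G} → IsWZPair F G → ∀ N K →
               partial (λ n → F n K) N - partial (λ n → F n 0) N ≡ partial (G N) K - partial (G 0) K
wz-rectangle {F} {G} wz N zero = +-inverseʳ (partial (λ n → F n 0) N)
wz-rectangle {F} {G} wz N (suc K) = begin
  ΣF (suc K) - ΣF 0                        ≡⟨ split (ΣF (suc K)) (ΣF K) (ΣF 0) ⟩
  (ΣF (suc K) - ΣF K) + (ΣF K - ΣF 0)      ≡⟨ cong₂ _+_ column (wz-rectangle {F} {G} wz N K) ⟩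
  (G N K - G 0 K) + (partial (G N) K - partial (G 0) K)
                                           ≡⟨ interchange (G N K) (G 0 K) (partial (G N) K) (partial (G 0) K) ⟩
  partial (G N) (suc K) - partial (G 0) (suc K) ∎
  where
  open ≡-Reasoning
  ΣF : ℕ → ℚ
  ΣF K = partial (λ n → F n K) N
  column : ΣF (suc K) - ΣF K ≡ G N K - G 0 K
  column = trans (sym (partial-sub (λ n → F n (suc K)) (λ n → F n K) N))
                 (trans (partial-cong {g = λ n → G (suc n) K - G n K} (λ n → wz n K) N) (partial-telescope (λ n → G n K) N))
  split : ∀ a b c → a - c ≡ (a - b) + (b - c)
  split = solve-∀ ℚ-ring
  interchange : ∀ a b c d → (a - b) + (c - d) ≡ (c + a) - (d + b)
  interchange = solve-∀ ℚ-ring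

odd : ℕ → ℕ → ℚ
odd n k = 2 * fromℕ k + 2 * fromℕ n + 1

1/odd : ℕ → ℕ → ℚ
1/odd n k = inv (odd n k)

1/suc : ℕ → ℚ
1/suc n = inv (fromℕ (suc n))

2*-nonNeg : ∀ {x} → 0ℚ ≤ x → 0ℚ ≤ 2 * x
2*-nonNeg = *-nonNeg (nonNegative⁻¹ 2)

odd-pos : ∀ n k → 0ℚ < odd n k
odd-pos n k = nonNeg+pos (+-nonNeg (2*-nonNeg (fromℕ-nonNeg k)) (2*-nonNeg (fromℕ-nonNeg n))) (positive⁻¹ 1ℚ)

suc-pos : ∀ n → 0ℚ < fromℕ (suc n)
suc-pos n = subst (0ℚ <_) (+-comm (fromℕ n) 1ℚ) (nonNeg+pos (fromℕ-nonNeg n) (positive⁻¹ 1ℚ))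

odd-inverse : ∀ n k → odd n k * 1/odd n k ≡ 1ℚ
odd-inverse n k = inv-inverseʳ (pos⇒≢0 (odd-pos n k))

suc-inverse : ∀ n → fromℕ (suc n) * 1/suc n ≡ 1ℚ
suc-inverse n = inv-inverseʳ (pos⇒≢0 (suc-pos n))

1/odd-nonNeg : ∀ n k → 0ℚ ≤ 1/odd n k
1/odd-nonNeg n k = <⇒≤ (inv-pos (odd-pos n k))

1/suc-nonNeg : ∀ n → 0ℚ ≤ 1/suc n
1/suc-nonNeg n = <⇒≤ (inv-pos (suc-pos n))

odd-suc : ∀ n k → odd n (suc k) ≡ odd (suc n) k
odd-suc n k = shift (fromℕ k) (fromℕ n)
  where
  shift : ∀ K N → 2 * (1ℚ + K) + 2 * N + 1 ≡ 2 * K + 2 * (1ℚ + N) + 1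
  shift = solve-∀ ℚ-ring

1/odd-suc : ∀ n k → 1/odd n (suc k) ≡ 1/odd (suc n) k
1/odd-suc n k = cong inv (odd-suc n k)

odd-sym : ∀ n k → odd n k ≡ odd k n
odd-sym n k = cong (_+ 1ℚ) (+-comm (2 * fromℕ k) (2 * fromℕ n))

1/odd-corner : ∀ n → 1/odd (suc n) 0 ≡ 1/odd 1 n
1/odd-corner n = cong inv (trans (odd-sym (suc n) 0) (odd-suc 0 n))

sign : ℕ → ℚ
sign zero    = 1ℚ
sign (suc n) = - sign n

-- In closed form, catalanKernel n k = 2ⁿ n! / ((2k+1)(2k+3)⋯(2k+2n−1) (2k+2n+1)²).

catalanRatio : ℕ → ℕ → ℚ
catalanRatio n k = 2 * fromℕ (suc n) * odd n k * (1/odd (suc n) k * 1/odd (suc n) k)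

catalanKernel : ℕ → ℕ → ℚ
catalanKernel zero    k = 1/odd 0 k * 1/odd 0 k
catalanKernel (suc n) k = catalanKernel n k * catalanRatio n k

catalanF : ℕ → ℕ → ℚ
catalanF n k = sign k * catalanKernel n k

catalanG : ℕ → ℕ → ℚ
catalanG n k = catalanF n k * (2 * (2 * fromℕ k + fromℕ n + 1) * 1/odd 0 k)

catalanKernel-suc : ∀ n k → catalanKernel n (suc k) ≡
                    catalanKernel n k * (odd 0 k * odd n k * (1/odd (suc n) k * 1/odd (suc n) k))
catalanKernel-suc zero k = begin
  1/odd 0 (suc k) * 1/odd 0 (suc k)         ≡⟨ cong (λ x → x * x) (1/odd-suc 0 k) ⟩
  x * x                                     ≡⟨ *-identityˡ (x * x) ⟨
  1ℚ * (x * x)                              ≡⟨ cong (λ u → u * u * (x * x)) (odd-inverse 0 k) ⟨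
  (a * i) * (a * i) * (x * x)               ≡⟨ regroup a i x ⟩
  i * i * (a * a * (x * x))                 ∎
  where
  open ≡-Reasoning
  a = odd 0 k
  i = 1/odd 0 k
  x = 1/odd 1 k
  regroup : ∀ a i x → (a * i) * (a * i) * (x * x) ≡ i * i * (a * a * (x * x))
  regroup = solve-∀ ℚ-ring
catalanKernel-suc (suc n) k = begin
  catalanKernel n (suc k) * (t * odd n (suc k) * (z′ * z′))
      ≡⟨ cong₂ (λ m c → m * (t * c * (z′ * z′))) (catalanKernel-suc n k) (odd-suc n k) ⟩
  catalanKernel n k * (a * b * (y * y)) * (t * c * (z′ * z′))
      ≡⟨ cong (λ z → catalanKernel n k * (a * b * (y * y)) * (t * c * (z * z))) (1/odd-suc (suc n) k) ⟩
  catalanKernel n k * (a * b * (y * y)) * (t * c * (z * z))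
      ≡⟨ swap (catalanKernel n k) a b c t y z ⟩
  catalanKernel n k * (t * b * (y * y)) * (a * c * (z * z)) ∎
  where
  open ≡-Reasoning
  t = 2 * fromℕ (suc n)
  a = odd 0 k
  b = odd n k
  c = odd (suc n) k
  y = 1/odd (suc n) k
  z = 1/odd (suc (suc n)) k
  z′ = 1/odd (suc n) (suc k)
  swap : ∀ m a b c t y z → m * (a * b * (y * y)) * (t * c * (z * z)) ≡ m * (t * b * (y * y)) * (a * c * (z * z))
  swap = solve-∀ ℚ-ring

catalanWZ : IsWZPair catalanF catalanG
catalanWZ n k = ≡-by-clearing (a * (c * c)) D≢0 FL FR (odd-inverse 0 k) (odd-inverse (suc n) k)
  (trans (cong (λ x → ((- s) * x - s * m) * (a * (c * c))) (catalanKernel-suc n k)) (cleared-lhs s m a b c y))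
  (cleared-rhs s m a b c t y i K N)
  (certificate s m K N)
  where
  s = sign k
  m = catalanKernel n k
  K = fromℕ k
  N = fromℕ n
  a = odd 0 k
  b = odd n k
  c = odd (suc n) k
  t = 2 * fromℕ (suc n)
  i = 1/odd 0 k
  y = 1/odd (suc n) k
  D≢0 : a * (c * c) ≢ 0ℚ
  D≢0 = pos⇒≢0 (*-pos (odd-pos 0 k) (*-pos (odd-pos (suc n) k) (odd-pos (suc n) k)))
  FL FR : ℚ → ℚ → ℚ
  FL p q = - (s * m * a * a * b) * (q * q) - s * m * a * (c * c)
  FR p q = s * m * t * b * (2 * (2 * K + (1ℚ + N) + 1)) * p * (q * q) - s * m * (2 * (2 * K + N + 1)) * (c * c) * p
  cleared-lhs : ∀ s m a b c y → ((- s) * (m * (a * b * (y * y))) - s * m) * (a * (c * c))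
                              ≡ - (s * m * a * a * b) * ((c * y) * (c * y)) - s * m * a * (c * c)
  cleared-lhs = solve-∀ ℚ-ring
  cleared-rhs : ∀ s m a b c t y i K N →
    (s * (m * (t * b * (y * y))) * (2 * (2 * K + (1ℚ + N) + 1) * i) - s * m * (2 * (2 * K + N + 1) * i)) * (a * (c * c))
    ≡ s * m * t * b * (2 * (2 * K + (1ℚ + N) + 1)) * (a * i) * ((c * y) * (c * y)) - s * m * (2 * (2 * K + N + 1)) * (c * c) * (a * i)
  cleared-rhs = solve-∀ ℚ-ring
  certificate : ∀ s m K N →
    let A = 2 * K + 2 * 0ℚ + 1 ; B = 2 * K + 2 * N + 1 ; C = 2 * K + 2 * (1ℚ + N) + 1 in
    - (s * m * A * A * B) * (1ℚ * 1ℚ) - s * m * A * (C * C)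
    ≡ s * m * (2 * (1ℚ + N)) * B * (2 * (2 * K + (1ℚ + N) + 1)) * 1ℚ * (1ℚ * 1ℚ) - s * m * (2 * (2 * K + N + 1)) * (C * C) * 1ℚ
  certificate = solve-∀ ℚ-ring

-- In closed form, rhsKernel 0 k = 4ᵏ k!² / ((2k+1)! (2k+1)) = P(k).

rhsRatio : ℕ → ℕ → ℚ
rhsRatio n k = fromℕ (suc n) * fromℕ (suc n) * (2 * fromℕ k + fromℕ n + 1) * 1/odd (suc n) 0
               * (1/odd (suc n) k * 1/odd (suc n) k)

rhsKernel : ℕ → ℕ → ℚ
rhsKernel zero    zero    = 1ℚ
rhsKernel zero    (suc k) = rhsKernel zero k * (odd 0 k * (2 * fromℕ (suc k)) * (1/odd 1 k * 1/odd 1 k))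
rhsKernel (suc n) k       = rhsKernel n k * rhsRatio n k

rhsF : ℕ → ℕ → ℚ
rhsF n k = sign n * rhsKernel n k * (6 * fromℕ n + 4 * fromℕ k + 4)

rhsG : ℕ → ℕ → ℚ
rhsG n k = sign n * rhsKernel n k * (4 * fromℕ n + 2)

rhsKernel-suc : ∀ n k → rhsKernel n (suc k) ≡
  rhsKernel n k * ((2 * fromℕ k + fromℕ n + 1) * (2 * fromℕ k + fromℕ n + 2) * (1/odd (suc n) k * 1/odd (suc n) k))
rhsKernel-suc zero k = reshape (rhsKernel 0 k) (fromℕ k) (1/odd 1 k)
  where
  reshape : ∀ m K y → m * ((2 * K + 2 * 0ℚ + 1) * (2 * (1ℚ + K)) * (y * y)) ≡ m * ((2 * K + 0ℚ + 1) * (2 * K + 0ℚ + 2) * (y * y))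
  reshape = solve-∀ ℚ-ring
rhsKernel-suc (suc n) k = begin
  rhsKernel n (suc k) * (u * u * (2 * (1ℚ + K) + N + 1) * e * (z′ * z′))
      ≡⟨ cong₂ (λ m z → m * (u * u * (2 * (1ℚ + K) + N + 1) * e * (z * z)))
               (rhsKernel-suc n k) (1/odd-suc (suc n) k) ⟩
  rhsKernel n k * ((2 * K + N + 1) * (2 * K + N + 2) * (y * y)) * (u * u * (2 * (1ℚ + K) + N + 1) * e * (z * z))
      ≡⟨ swap (rhsKernel n k) K N e y z ⟩
  rhsKernel n k * (u * u * (2 * K + N + 1) * e * (y * y)) * ((2 * K + u + 1) * (2 * K + u + 2) * (z * z)) ∎
  where
  open ≡-Reasoning
  K = fromℕ k
  N = fromℕ n
  u = fromℕ (suc n)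
  e = 1/odd (suc n) 0
  y = 1/odd (suc n) k
  z = 1/odd (suc (suc n)) k
  z′ = 1/odd (suc n) (suc k)
  swap : ∀ m K N e y z →
    m * ((2 * K + N + 1) * (2 * K + N + 2) * (y * y)) * ((1ℚ + N) * (1ℚ + N) * (2 * (1ℚ + K) + N + 1) * e * (z * z))
    ≡ m * ((1ℚ + N) * (1ℚ + N) * (2 * K + N + 1) * e * (y * y)) * ((2 * K + (1ℚ + N) + 1) * (2 * K + (1ℚ + N) + 2) * (z * z))
  swap = solve-∀ ℚ-ring

rhsWZ : IsWZPair rhsF rhsG
rhsWZ n k = ≡-by-clearing (c₀ * (c * c)) D≢0 FL FR (odd-inverse (suc n) 0) (odd-inverse (suc n) k)
  (trans (cong (λ x → ((s * x) * (6 * N + 4 * (1ℚ + K) + 4) - s * m * (6 * N + 4 * K + 4)) * (c₀ * (c * c)))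
               (rhsKernel-suc n k))
         (cleared-lhs s m K N c₀ c y))
  (cleared-rhs s m K N c₀ c e y)
  (certificate s m K N)
  where
  s = sign n
  m = rhsKernel n k
  K = fromℕ k
  N = fromℕ n
  c₀ = odd (suc n) 0
  c = odd (suc n) k
  e = 1/odd (suc n) 0
  y = 1/odd (suc n) k
  D≢0 : c₀ * (c * c) ≢ 0ℚ
  D≢0 = pos⇒≢0 (*-pos (odd-pos (suc n) 0) (*-pos (odd-pos (suc n) k) (odd-pos (suc n) k)))
  FL FR : ℚ → ℚ → ℚ
  FL p q = s * m * ((2 * K + N + 1) * (2 * K + N + 2) * (6 * N + 4 * (1ℚ + K) + 4)) * c₀ * (q * q)
           - s * m * (6 * N + 4 * K + 4) * c₀ * (c * c)
  FR p q = - (s * m * ((1ℚ + N) * (1ℚ + N) * (2 * K + N + 1) * (4 * (1ℚ + N) + 2))) * p * (q * q)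
           - s * m * (4 * N + 2) * c₀ * (c * c)
  cleared-lhs : ∀ s m K N c₀ c y →
    ((s * (m * ((2 * K + N + 1) * (2 * K + N + 2) * (y * y)))) * (6 * N + 4 * (1ℚ + K) + 4) - s * m * (6 * N + 4 * K + 4)) * (c₀ * (c * c))
    ≡ s * m * ((2 * K + N + 1) * (2 * K + N + 2) * (6 * N + 4 * (1ℚ + K) + 4)) * c₀ * ((c * y) * (c * y))
      - s * m * (6 * N + 4 * K + 4) * c₀ * (c * c)
  cleared-lhs = solve-∀ ℚ-ring
  cleared-rhs : ∀ s m K N c₀ c e y →
    ((- s) * (m * ((1ℚ + N) * (1ℚ + N) * (2 * K + N + 1) * e * (y * y))) * (4 * (1ℚ + N) + 2) - s * m * (4 * N + 2)) * (c₀ * (c * c))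
    ≡ - (s * m * ((1ℚ + N) * (1ℚ + N) * (2 * K + N + 1) * (4 * (1ℚ + N) + 2))) * (c₀ * e) * ((c * y) * (c * y))
      - s * m * (4 * N + 2) * c₀ * (c * c)
  cleared-rhs = solve-∀ ℚ-ring
  certificate : ∀ s m K N →
    let C₀ = 2 * 0ℚ + 2 * (1ℚ + N) + 1 ; C = 2 * K + 2 * (1ℚ + N) + 1 in
    s * m * ((2 * K + N + 1) * (2 * K + N + 2) * (6 * N + 4 * (1ℚ + K) + 4)) * C₀ * (1ℚ * 1ℚ) - s * m * (6 * N + 4 * K + 4) * C₀ * (C * C)
    ≡ - (s * m * ((1ℚ + N) * (1ℚ + N) * (2 * K + N + 1) * (4 * (1ℚ + N) + 2))) * 1ℚ * (1ℚ * 1ℚ) - s * m * (4 * N + 2) * C₀ * (C * C)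
  certificate = solve-∀ ℚ-ring

fromℤ : ℤ → ℚ
fromℤ (+ n)      = fromℕ n
fromℤ -[1+ n ]   = - fromℕ (suc n)

fromℤ-neg : ∀ z → fromℤ (ℤ.- z) ≡ - fromℤ z
fromℤ-neg (+ zero)   = refl
fromℤ-neg (+ suc n)  = refl
fromℤ-neg -[1+ n ]   = sym (neg-involutive (fromℕ (suc n)))
  where
  neg-involutive : ∀ x → - (- x) ≡ x
  neg-involutive = solve-∀ ℚ-ring

fromℤ-sgn : ∀ k → fromℤ (sgn k) ≡ sign k
fromℤ-sgn zero    = refl
fromℤ-sgn (suc k) = trans (fromℤ-neg (sgn k)) (cong -_ (fromℤ-sgn k))

fromℤ-sgn* : ∀ k m → fromℤ (sgn k ℤ.* + m) ≡ sign k * fromℕ m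
fromℤ-sgn* zero    m = trans (cong fromℤ (ℤ.*-identityˡ (+ m))) (sym (*-identityˡ (fromℕ m)))
fromℤ-sgn* (suc k) m = begin
  fromℤ (ℤ.- sgn k ℤ.* + m)     ≡⟨ cong fromℤ (ℤ.neg-distribˡ-* (sgn k) (+ m)) ⟨
  fromℤ (ℤ.- (sgn k ℤ.* + m))   ≡⟨ fromℤ-neg (sgn k ℤ.* + m) ⟩
  - fromℤ (sgn k ℤ.* + m)       ≡⟨ cong -_ (fromℤ-sgn* k m) ⟩
  - (sign k * fromℕ m)          ≡⟨ neg-distribˡ-* (sign k) (fromℕ m) ⟩
  - sign k * fromℕ m            ∎
  where open ≡-Reasoning

toℚᵘ-fromℕ : ∀ m → toℚᵘ (fromℕ m) ℚᵘ.≃ ℚᵘ.mkℚᵘ (+ m) 0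
toℚᵘ-fromℕ zero    = ℚᵘ.*≡* refl
toℚᵘ-fromℕ (suc m) = ℚᵘ.≃-trans (toℚᵘ-homo-+ 1ℚ (fromℕ m))
  (ℚᵘ.≃-trans (ℚᵘ.+-cong (ℚᵘ.≃-refl {toℚᵘ 1ℚ}) (toℚᵘ-fromℕ m)) (ℚᵘ.*≡* (cross-multiplied m)))
  where
  cross-multiplied : ∀ m → (+ 1 ℤ.* + 1 ℤ.+ + m ℤ.* + 1) ℤ.* + 1 ≡ + suc m ℤ.* + (1 ℕ.* 1)
  cross-multiplied m = trans (ℤ.*-identityʳ _) (trans (cong (λ x → + 1 ℤ.+ x) (ℤ.*-identityʳ (+ m)))
                                                      (sym (ℤ.*-identityʳ (+ suc m))))

toℚᵘ-fromℤ : ∀ z → toℚᵘ (fromℤ z) ℚᵘ.≃ ℚᵘ.mkℚᵘ z 0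
toℚᵘ-fromℤ (+ n)    = toℚᵘ-fromℕ n
toℚᵘ-fromℤ -[1+ n ] = ℚᵘ.≃-trans (toℚᵘ-homo‿- (fromℕ (suc n))) (ℚᵘ.-‿cong (toℚᵘ-fromℕ (suc n)))

/′-*-denominator : ∀ z d → 0 ℕ.< d → (z /′ d) * fromℕ d ≡ fromℤ z
/′-*-denominator z (suc d) _ = toℚᵘ-injective (ℚᵘ.≃-trans (toℚᵘ-homo-* (z /′ suc d) (fromℕ (suc d)))
  (ℚᵘ.≃-trans (ℚᵘ.*-cong (toℚᵘ-fromℚᵘ (ℚᵘ.mkℚᵘ z d)) (toℚᵘ-fromℕ (suc d)))
  (ℚᵘ.≃-trans (ℚᵘ.*≡* cross-multiplied) (ℚᵘ.≃-sym (toℚᵘ-fromℤ z)))))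
  where
  cross-multiplied : (z ℤ.* + suc d) ℤ.* + 1 ≡ z ℤ.* + suc (d ℕ.* 1)
  cross-multiplied = trans (ℤ.*-identityʳ _) (cong (λ x → z ℤ.* + suc x) (sym (ℕ.*-identityʳ d)))

fromℕ-2k+1 : ∀ k → fromℕ (2 ℕ.* k ℕ.+ 1) ≡ odd 0 k
fromℕ-2k+1 k = trans (fromℕ-+ (2 ℕ.* k) 1) (trans (cong (_+ 1ℚ) (fromℕ-* 2 k)) (reshape (fromℕ k)))
  where
  reshape : ∀ K → 2 * K + 1ℚ ≡ 2 * K + 2 * 0ℚ + 1
  reshape = solve-∀ ℚ-ring

catalanTerm≡ : ∀ k → catalanTerm k ≡ sign k * (1/odd 0 k * 1/odd 0 k)
catalanTerm≡ k = *-cancelʳ-≡ (a * a) (pos⇒≢0 (*-pos (odd-pos 0 k) (odd-pos 0 k))) (begin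
  catalanTerm k * (a * a)             ≡⟨ cong (catalanTerm k *_) fromℕ-d ⟨
  catalanTerm k * fromℕ d             ≡⟨ /′-*-denominator (sgn k) d d>0 ⟩
  fromℤ (sgn k)                       ≡⟨ fromℤ-sgn k ⟩
  sign k                              ≡⟨ *-identityʳ (sign k) ⟨
  sign k * (1ℚ * 1ℚ)                  ≡⟨ cong (λ u → sign k * (u * u)) (odd-inverse 0 k) ⟨
  sign k * ((a * i) * (a * i))        ≡⟨ regroup (sign k) a i ⟩
  sign k * (i * i) * (a * a)          ∎)
  where
  open ≡-Reasoning
  a = odd 0 k
  i = 1/odd 0 k
  d = (2 ℕ.* k ℕ.+ 1) ℕ.^ 2
  d>0 : 0 ℕ.< d
  d>0 = ℕ.m^n>0 (2 ℕ.* k ℕ.+ 1) {{ℕ.>-nonZero (subst (0 ℕ.<_) (ℕ.+-comm 1 (2 ℕ.* k)) ℕ.z<s)}} 2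
  fromℕ-d : fromℕ d ≡ a * a
  fromℕ-d = trans (fromℕ-* (2 ℕ.* k ℕ.+ 1) _) (trans (cong (fromℕ (2 ℕ.* k ℕ.+ 1) *_) (fromℕ-* (2 ℕ.* k ℕ.+ 1) 1))
            (trans (cong (λ x → x * (x * 1ℚ)) (fromℕ-2k+1 k)) (cong (a *_) (*-identityʳ a))))
  regroup : ∀ s a i → s * ((a * i) * (a * i)) ≡ s * (i * i) * (a * a)
  regroup = solve-∀ ℚ-ring

-- Boundary values

catalanG-zero : ∀ k → catalanG 0 k ≡ 2 * catalanTerm k
catalanG-zero k = begin
  sign k * (i * i) * (2 * (2 * fromℕ k + 0ℚ + 1) * i)   ≡⟨ regroup (sign k) i (fromℕ k) ⟩
  2 * (sign k * (i * i)) * (odd 0 k * i)               ≡⟨ cong (2 * (sign k * (i * i)) *_) (odd-inverse 0 k) ⟩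
  2 * (sign k * (i * i)) * 1ℚ                          ≡⟨ *-identityʳ _ ⟩
  2 * (sign k * (i * i))                               ≡⟨ cong (2 *_) (catalanTerm≡ k) ⟨
  2 * catalanTerm k                                    ∎
  where
  open ≡-Reasoning
  i = 1/odd 0 k
  regroup : ∀ s i K → s * (i * i) * (2 * (2 * K + 0ℚ + 1) * i) ≡ 2 * (s * (i * i)) * ((2 * K + 2 * 0ℚ + 1) * i)
  regroup = solve-∀ ℚ-ring

catalanKernel-zero : ∀ n → catalanKernel n 0 ≡ rhsKernel 0 n
catalanKernel-zero zero    = refl
catalanKernel-zero (suc n) = begin
  catalanKernel n 0 * (2 * fromℕ (suc n) * odd n 0 * (1/odd (suc n) 0 * 1/odd (suc n) 0))
      ≡⟨ cong₂ (λ m x → m * (2 * fromℕ (suc n) * odd n 0 * (x * x))) (catalanKernel-zero n) (1/odd-corner n) ⟩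
  rhsKernel 0 n * (2 * fromℕ (suc n) * odd n 0 * (y * y))
      ≡⟨ cong (λ b → rhsKernel 0 n * (2 * fromℕ (suc n) * b * (y * y))) (odd-sym n 0) ⟩
  rhsKernel 0 n * (2 * fromℕ (suc n) * odd 0 n * (y * y))
      ≡⟨ cong (rhsKernel 0 n *_) (cong (_* (y * y)) (*-comm (2 * fromℕ (suc n)) (odd 0 n))) ⟩
  rhsKernel 0 n * (odd 0 n * (2 * fromℕ (suc n)) * (y * y)) ∎
  where
  open ≡-Reasoning
  y = 1/odd 1 n

catalanF-zero : ∀ n → catalanF n 0 ≡ rhsKernel 0 n
catalanF-zero n = trans (*-identityˡ (catalanKernel n 0)) (catalanKernel-zero n)

rhsG-zero : ∀ k → rhsG 0 k ≡ 2 * rhsKernel 0 k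
rhsG-zero k = reshape (rhsKernel 0 k)
  where
  reshape : ∀ m → 1ℚ * m * (4 * 0ℚ + 2) ≡ 2 * m
  reshape = solve-∀ ℚ-ring

central*n!*n!≡[2n]! : ∀ n → central n ℕ.* (n ! ℕ.* n !) ≡ (2 ℕ.* n) !
central*n!*n!≡[2n]! n = begin
  central n ℕ.* (n ! ℕ.* n !)               ≡⟨ cong (λ x → central n ℕ.* (n ! ℕ.* x !)) 2n∸n≡n ⟨
  central n ℕ.* (n ! ℕ.* (2 ℕ.* n ℕ.∸ n) !)  ≡⟨ cong (ℕ._* (n ! ℕ.* (2 ℕ.* n ℕ.∸ n) !)) (nCk≡n!/k![n-k]! n≤2n) ⟩
  ((2 ℕ.* n) ! ℕ./ (n ! ℕ.* (2 ℕ.* n ℕ.∸ n) !)) {{n!*m!≢0}} ℕ.* (n ! ℕ.* (2 ℕ.* n ℕ.∸ n) !)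
                                            ≡⟨ m/n*n≡m {{n!*m!≢0}} (k![n∸k]!∣n! n≤2n) ⟩
  (2 ℕ.* n) !                               ∎
  where
  open ≡-Reasoning
  n≤2n : n ℕ.≤ 2 ℕ.* n
  n≤2n = ℕ.m≤m+n n (n ℕ.+ 0)
  2n∸n≡n : 2 ℕ.* n ℕ.∸ n ≡ n
  2n∸n≡n = trans (ℕ.m+n∸m≡n n (n ℕ.+ 0)) (ℕ.+-identityʳ n)
  n!*m!≢0 : ℕ.NonZero (n ! ℕ.* (2 ℕ.* n ℕ.∸ n) !)
  n!*m!≢0 = ℕ._!*_!≢0 n (2 ℕ.* n ℕ.∸ n)

central≢0 : ∀ n → ℕ.NonZero (central n)
central≢0 n = ℕ.≢-nonZero λ central≡0 → ℕ.<⇒≢ (ℕ.1≤n! (2 ℕ.* n))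
  (sym (trans (sym (central*n!*n!≡[2n]! n)) (cong (ℕ._* (n ! ℕ.* n !)) central≡0)))

fromℕ-cube : ∀ m → fromℕ (m ℕ.^ 3) ≡ fromℕ m * fromℕ m * fromℕ m
fromℕ-cube m = trans (fromℕ-* m (m ℕ.^ 2)) (trans (cong (fromℕ m *_)
  (trans (fromℕ-* m (m ℕ.^ 1)) (cong (fromℕ m *_) (fromℕ-* m 1)))) (reshape (fromℕ m)))
  where
  reshape : ∀ x → x * (x * (x * 1ℚ)) ≡ x * x * x
  reshape = solve-∀ ℚ-ring

rhsKernel-factorials : ∀ n → let c = odd n 0 ; G = fromℕ ((2 ℕ.* n) !) ; F = fromℕ (n !) in
  rhsKernel n 0 * (c * c * c) * (G * G * G) ≡ fromℕ (8 ℕ.^ n) * (F * F * F * F * F * F)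
rhsKernel-factorials zero    = refl
rhsKernel-factorials (suc n) = begin
  m * (u * u * (2 * 0ℚ + N + 1) * e * (e * e)) * (c′ * c′ * c′) * (G′ * G′ * G′)
      ≡⟨ cong (λ g → m * (u * u * (2 * 0ℚ + N + 1) * e * (e * e)) * (c′ * c′ * c′) * (g * g * g)) [2n+2]! ⟩
  m * (u * u * (2 * 0ℚ + N + 1) * e * (e * e)) * (c′ * c′ * c′) * (H * H * H)
      ≡⟨ regroup m N e c′ G ⟩
  m * (c * c * c) * (G * G * G) * (8 * (u * u * u * u * u * u)) * ((c′ * e) * (c′ * e) * (c′ * e))
      ≡⟨ cong₂ (λ x p → x * (8 * (u * u * u * u * u * u)) * (p * p * p))
               (rhsKernel-factorials n) (odd-inverse (suc n) 0) ⟩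
  E * (F * F * F * F * F * F) * (8 * (u * u * u * u * u * u)) * (1ℚ * 1ℚ * 1ℚ)
      ≡⟨ collect E F u ⟩
  (8 * E) * (uF * uF * uF * uF * uF * uF)
      ≡⟨ cong₂ (λ x y → x * (y * y * y * y * y * y)) (fromℕ-* 8 (8 ℕ.^ n)) (fromℕ-* (suc n) (n !)) ⟨
  fromℕ (8 ℕ.^ suc n) * (F′ * F′ * F′ * F′ * F′ * F′) ∎
  where
  open ≡-Reasoning
  m = rhsKernel n 0
  N = fromℕ n
  u = fromℕ (suc n)
  c = odd n 0
  c′ = odd (suc n) 0
  e = 1/odd (suc n) 0
  G = fromℕ ((2 ℕ.* n) !)
  G′ = fromℕ ((2 ℕ.* suc n) !)
  H = (2 * N + 2) * ((2 * N + 1) * G)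
  E = fromℕ (8 ℕ.^ n)
  F = fromℕ (n !)
  F′ = fromℕ (suc n !)
  uF = u * F
  [2n+2]! : G′ ≡ H
  [2n+2]! = begin
    fromℕ ((2 ℕ.* suc n) !)                        ≡⟨ cong (λ x → fromℕ (x !)) (ℕ.*-suc 2 n) ⟩
    fromℕ (suc (suc (2 ℕ.* n)) ℕ.* (suc (2 ℕ.* n) ℕ.* (2 ℕ.* n) !))
        ≡⟨ trans (fromℕ-* (suc (suc (2 ℕ.* n))) (suc (2 ℕ.* n) ℕ.* (2 ℕ.* n) !))
                 (cong (fromℕ (suc (suc (2 ℕ.* n))) *_) (fromℕ-* (suc (2 ℕ.* n)) ((2 ℕ.* n) !))) ⟩
    (1ℚ + (1ℚ + fromℕ (2 ℕ.* n))) * ((1ℚ + fromℕ (2 ℕ.* n)) * G)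
        ≡⟨ cong (λ y → (1ℚ + (1ℚ + y)) * ((1ℚ + y) * G)) (fromℕ-* 2 n) ⟩
    (1ℚ + (1ℚ + 2 * N)) * ((1ℚ + 2 * N) * G)       ≡⟨ reshape N G ⟩
    H                                              ∎
    where
    reshape : ∀ x g → (1ℚ + (1ℚ + 2 * x)) * ((1ℚ + 2 * x) * g) ≡ (2 * x + 2) * ((2 * x + 1) * g)
    reshape = solve-∀ ℚ-ring
  regroup : ∀ m N e c′ G →
    m * ((1ℚ + N) * (1ℚ + N) * (2 * 0ℚ + N + 1) * e * (e * e)) * (c′ * c′ * c′) * (((2 * N + 2) * ((2 * N + 1) * G)) * ((2 * N + 2) * ((2 * N + 1) * G)) * ((2 * N + 2) * ((2 * N + 1) * G)))
    ≡ m * ((2 * 0ℚ + 2 * N + 1) * (2 * 0ℚ + 2 * N + 1) * (2 * 0ℚ + 2 * N + 1)) * (G * G * G) * (8 * ((1ℚ + N) * (1ℚ + N) * (1ℚ + N) * (1ℚ + N) * (1ℚ + N) * (1ℚ + N))) * ((c′ * e) * (c′ * e) * (c′ * e))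
  regroup = solve-∀ ℚ-ring
  collect : ∀ E F u → E * (F * F * F * F * F * F) * (8 * (u * u * u * u * u * u)) * (1ℚ * 1ℚ * 1ℚ)
                    ≡ (8 * E) * ((u * F) * (u * F) * (u * F) * (u * F) * (u * F) * (u * F))
  collect = solve-∀ ℚ-ring

fromℕ-pos : ∀ {m} → 0 ℕ.< m → 0ℚ < fromℕ m
fromℕ-pos {suc m} _ = suc-pos m

rhsKernel-central : ∀ n → let c = odd n 0 ; C = fromℕ (central n) in
  rhsKernel n 0 * ((c * c * c) * (C * C * C)) ≡ fromℕ (8 ℕ.^ n)
rhsKernel-central n = *-cancelʳ-≡ F⁶ F⁶≢0 (begin
  m * ((c * c * c) * (C * C * C)) * F⁶             ≡⟨ regroup m c C F ⟩
  m * (c * c * c) * ((C * (F * F)) * (C * (F * F)) * (C * (F * F)))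
                                                  ≡⟨ cong (λ g → m * (c * c * c) * (g * g * g)) C*F*F≡G ⟩
  m * (c * c * c) * (G * G * G)                   ≡⟨ rhsKernel-factorials n ⟩
  fromℕ (8 ℕ.^ n) * F⁶                            ∎)
  where
  open ≡-Reasoning
  m = rhsKernel n 0
  c = odd n 0
  C = fromℕ (central n)
  F = fromℕ (n !)
  G = fromℕ ((2 ℕ.* n) !)
  F⁶ = F * F * F * F * F * F
  F>0 : 0ℚ < F
  F>0 = fromℕ-pos (ℕ.1≤n! n)
  F⁶≢0 : F⁶ ≢ 0ℚ
  F⁶≢0 = pos⇒≢0 (*-pos (*-pos (*-pos (*-pos (*-pos F>0 F>0) F>0) F>0) F>0) F>0)
  C*F*F≡G : C * (F * F) ≡ G
  C*F*F≡G = trans (cong (C *_) (sym (fromℕ-* (n !) (n !))))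
                  (trans (sym (fromℕ-* (central n) (n ! ℕ.* n !))) (cong fromℕ (central*n!*n!≡[2n]! n)))
  regroup : ∀ m c C F → m * ((c * c * c) * (C * C * C)) * (F * F * F * F * F * F)
                        ≡ m * (c * c * c) * ((C * (F * F)) * (C * (F * F)) * (C * (F * F)))
  regroup = solve-∀ ℚ-ring

rhsF-zero : ∀ n → rhsF n 0 ≡ 4 * rhsTerm n
rhsF-zero n = *-cancelʳ-≡ (fromℕ d) (pos⇒≢0 (fromℕ-pos d>0)) (begin
  s * m * (6 * N + 4 * 0ℚ + 4) * fromℕ d     ≡⟨ cong (s * m * (6 * N + 4 * 0ℚ + 4) *_) fromℕ-d ⟩
  s * m * (6 * N + 4 * 0ℚ + 4) * (2 * T)     ≡⟨ regroup s m N T ⟩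
  s * (6 * N + 4) * 2 * (m * T)              ≡⟨ cong (s * (6 * N + 4) * 2 *_) (rhsKernel-central n) ⟩
  s * (6 * N + 4) * 2 * E                    ≡⟨ regroup′ s N E ⟩
  4 * (s * ((3 * N + 2) * E))                ≡⟨ cong (4 *_) rhsTerm-cleared ⟨
  4 * (rhsTerm n * fromℕ d)                  ≡⟨ *-assoc 4 (rhsTerm n) (fromℕ d) ⟨
  4 * rhsTerm n * fromℕ d                    ∎)
  where
  open ≡-Reasoning
  s = sign n
  m = rhsKernel n 0
  N = fromℕ n
  E = fromℕ (8 ℕ.^ n)
  c = odd n 0
  C = fromℕ (central n)
  T = (c * c * c) * (C * C * C)
  d = 2 ℕ.* ((2 ℕ.* n ℕ.+ 1) ℕ.^ 3 ℕ.* central n ℕ.^ 3)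
  d>0 : 0 ℕ.< d
  d>0 = ℕ.>-nonZero⁻¹ d {{ℕ.m*n≢0 2 _ {{_}} {{ℕ.m*n≢0 _ _
          {{ℕ.m^n≢0 (2 ℕ.* n ℕ.+ 1) 3 {{ℕ.>-nonZero (subst (0 ℕ.<_) (ℕ.+-comm 1 (2 ℕ.* n)) ℕ.z<s)}}}}
          {{ℕ.m^n≢0 (central n) 3 {{central≢0 n}}}}}}}}
  fromℕ-d : fromℕ d ≡ 2 * T
  fromℕ-d = trans (fromℕ-* 2 ((2 ℕ.* n ℕ.+ 1) ℕ.^ 3 ℕ.* central n ℕ.^ 3)) (cong (2 *_) (trans (fromℕ-* ((2 ℕ.* n ℕ.+ 1) ℕ.^ 3) (central n ℕ.^ 3))
              (cong₂ _*_ (trans (fromℕ-cube (2 ℕ.* n ℕ.+ 1)) (cong (λ q → q * q * q) (trans (fromℕ-2k+1 n) (odd-sym 0 n))))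
                         (fromℕ-cube (central n)))))
  rhsTerm-cleared : rhsTerm n * fromℕ d ≡ s * ((3 * N + 2) * E)
  rhsTerm-cleared = trans (/′-*-denominator _ d d>0) (trans (fromℤ-sgn* n ((3 ℕ.* n ℕ.+ 2) ℕ.* 8 ℕ.^ n)) (cong (s *_)
    (trans (fromℕ-* (3 ℕ.* n ℕ.+ 2) (8 ℕ.^ n)) (cong (_* E) (trans (fromℕ-+ (3 ℕ.* n) 2) (cong (_+ 2) (fromℕ-* 3 n)))))))
  regroup : ∀ s m N T → s * m * (6 * N + 4 * 0ℚ + 4) * (2 * T) ≡ s * (6 * N + 4) * 2 * (m * T)
  regroup = solve-∀ ℚ-ring
  regroup′ : ∀ s N E → s * (6 * N + 4) * 2 * E ≡ 4 * (s * ((3 * N + 2) * E))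
  regroup′ = solve-∀ ℚ-ring

catalan-rhs-identity : ∀ n m → 4 * (partial catalanTerm n - partial rhsTerm n)
  ≡ 2 * partial (catalanG m) n - 2 * partial (λ j → catalanF j n) m - partial (λ j → rhsF j m) n + partial (rhsG n) m
catalan-rhs-identity n m = begin
  4 * (C - R)                                       ≡⟨ expand C R P X₁ Y₁ X₂ Y₂ ⟩
  Z + 2 * ((X₁ - P) - (Y₁ - 2 * C)) + ((X₂ - 4 * R) - (Y₂ - 2 * P))
                                                    ≡⟨ cong₂ (λ u v → Z + 2 * (u - (Y₁ - 2 * C)) + (v - (Y₂ - 2 * P)))
                                                             catalan-rectangle rhs-rectangle ⟩
  Z + 2 * ((Y₁ - 2 * C) - (Y₁ - 2 * C)) + ((Y₂ - 2 * P) - (Y₂ - 2 * P))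
                                                    ≡⟨ cancel Z (Y₁ - 2 * C) (Y₂ - 2 * P) ⟩
  Z                                                 ∎
  where
  open ≡-Reasoning
  C = partial catalanTerm n
  R = partial rhsTerm n
  P = partial (rhsKernel 0) m
  X₁ = partial (λ j → catalanF j n) m
  Y₁ = partial (catalanG m) n
  X₂ = partial (λ j → rhsF j m) n
  Y₂ = partial (rhsG n) m
  Z = 2 * Y₁ - 2 * X₁ - X₂ + Y₂
  catalan-rectangle : X₁ - P ≡ Y₁ - 2 * C
  catalan-rectangle = begin
    X₁ - P                                  ≡⟨ cong (λ x → X₁ - x) (partial-cong catalanF-zero m) ⟨
    X₁ - partial (λ j → catalanF j 0) m     ≡⟨ wz-rectangle {catalanF} {catalanG} catalanWZ m n ⟩
    Y₁ - partial (catalanG 0) n             ≡⟨ cong (λ x → Y₁ - x) (trans (partial-cong catalanG-zero n) (partial-scale 2 catalanTerm n)) ⟩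
    Y₁ - 2 * C                              ∎
  rhs-rectangle : X₂ - 4 * R ≡ Y₂ - 2 * P
  rhs-rectangle = begin
    X₂ - 4 * R                              ≡⟨ cong (λ x → X₂ - x) (trans (partial-cong rhsF-zero n) (partial-scale 4 rhsTerm n)) ⟨
    X₂ - partial (λ j → rhsF j 0) n         ≡⟨ wz-rectangle {rhsF} {rhsG} rhsWZ n m ⟩
    Y₂ - partial (rhsG 0) m                 ≡⟨ cong (λ x → Y₂ - x) (trans (partial-cong rhsG-zero m) (partial-scale 2 (rhsKernel 0) m)) ⟩
    Y₂ - 2 * P                              ∎
  expand : ∀ C R P X₁ Y₁ X₂ Y₂ → 4 * (C - R) ≡
    (2 * Y₁ - 2 * X₁ - X₂ + Y₂) + 2 * ((X₁ - P) - (Y₁ - 2 * C)) + ((X₂ - 4 * R) - (Y₂ - 2 * P))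
  expand = solve-∀ ℚ-ring
  cancel : ∀ z u v → z + 2 * (u - u) + (v - v) ≡ z
  cancel = solve-∀ ℚ-ring

-- Estimates

1/odd≤1 : ∀ n k → 1/odd n k ≤ 1ℚ
1/odd≤1 n k = inv-antitone (positive⁻¹ 1ℚ)
  (≤-from-slack (2 * fromℕ k + 2 * fromℕ n) (+-nonNeg (2*-nonNeg (fromℕ-nonNeg k)) (2*-nonNeg (fromℕ-nonNeg n)))
                (+-comm (2 * fromℕ k + 2 * fromℕ n) 1ℚ))

wallis : ℕ → ℚ
wallis zero    = 1ℚ
wallis (suc n) = wallis n * (2 * fromℕ (suc n) * 1/odd 1 n)

wallis-factor-nonNeg : ∀ n → 0ℚ ≤ 2 * fromℕ (suc n) * 1/odd 1 n
wallis-factor-nonNeg n = *-nonNeg (2*-nonNeg (fromℕ-nonNeg (suc n))) (1/odd-nonNeg 1 n)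

wallis-factor≤1 : ∀ n → 2 * fromℕ (suc n) * 1/odd 1 n ≤ 1ℚ
wallis-factor≤1 n = ≤-trans (*-monoʳ-≤ (1/odd 1 n) (1/odd-nonNeg 1 n) 2[n+1]≤2n+3) (≤-reflexive (odd-inverse 1 n))
  where
  2[n+1]≤2n+3 : 2 * fromℕ (suc n) ≤ odd 1 n
  2[n+1]≤2n+3 = ≤-from-slack 1ℚ (nonNegative⁻¹ 1ℚ) (reshape (fromℕ n))
    where
    reshape : ∀ N → 2 * N + 2 * (1ℚ + 0ℚ) + 1 ≡ 2 * (1ℚ + N) + 1ℚ
    reshape = solve-∀ ℚ-ring

wallis-nonNeg : ∀ n → 0ℚ ≤ wallis n
wallis-nonNeg zero    = nonNegative⁻¹ 1ℚ
wallis-nonNeg (suc n) = *-nonNeg (wallis-nonNeg n) (wallis-factor-nonNeg n)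

wallis≤1 : ∀ n → wallis n ≤ 1ℚ
wallis≤1 zero    = ≤-refl
wallis≤1 (suc n) = *-mono-≤ (wallis-nonNeg n) (wallis-factor-nonNeg n) (wallis≤1 n) (wallis-factor≤1 n)

wallis-step : ∀ n → 1/suc n * ((2 * fromℕ (suc n) * 1/odd 1 n) * (2 * fromℕ (suc n) * 1/odd 1 n)) ≤ 1/suc (suc n)
wallis-step n = ≤-by-clearing (u * u′ * (c * c)) D>0 FL FR (suc-inverse n) (odd-inverse 1 n) (suc-inverse (suc n))
  (cleared-lhs u u′ c h y) (cleared-rhs u u′ c h′)
  (≤-from-slack u (fromℕ-nonNeg (suc n)) (certificate (fromℕ n)))
  where
  u = fromℕ (suc n)
  u′ = fromℕ (suc (suc n))
  c = odd 1 n
  h = 1/suc n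
  h′ = 1/suc (suc n)
  y = 1/odd 1 n
  D>0 : 0ℚ < u * u′ * (c * c)
  D>0 = *-pos (*-pos (suc-pos n) (suc-pos (suc n))) (*-pos (odd-pos 1 n) (odd-pos 1 n))
  FL FR : ℚ → ℚ → ℚ → ℚ
  FL p q r = 4 * u * u * u′ * p * (q * q)
  FR p q r = u * (c * c) * r
  cleared-lhs : ∀ u u′ c h y → h * ((2 * u * y) * (2 * u * y)) * (u * u′ * (c * c)) ≡ 4 * u * u * u′ * (u * h) * ((c * y) * (c * y))
  cleared-lhs = solve-∀ ℚ-ring
  cleared-rhs : ∀ u u′ c h′ → h′ * (u * u′ * (c * c)) ≡ u * (c * c) * (u′ * h′)
  cleared-rhs = solve-∀ ℚ-ring
  certificate : ∀ N → (1ℚ + N) * ((2 * N + 2 * (1ℚ + 0ℚ) + 1) * (2 * N + 2 * (1ℚ + 0ℚ) + 1)) * 1ℚ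
                      ≡ 4 * (1ℚ + N) * (1ℚ + N) * (1ℚ + (1ℚ + N)) * 1ℚ * (1ℚ * 1ℚ) + (1ℚ + N)
  certificate = solve-∀ ℚ-ring

wallis²≤1/suc : ∀ n → wallis n * wallis n ≤ 1/suc n
wallis²≤1/suc zero    = ≤-refl
wallis²≤1/suc (suc n) = begin
  (wallis n * f) * (wallis n * f)   ≡⟨ interchange (wallis n) f ⟩
  (wallis n * wallis n) * (f * f)   ≤⟨ *-monoʳ-≤ (f * f) (*-nonNeg (wallis-factor-nonNeg n) (wallis-factor-nonNeg n)) (wallis²≤1/suc n) ⟩
  1/suc n * (f * f)                 ≤⟨ wallis-step n ⟩
  1/suc (suc n)                     ∎
  where
  open ≤-Reasoning
  f = 2 * fromℕ (suc n) * 1/odd 1 n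
  interchange : ∀ x f → (x * f) * (x * f) ≡ (x * x) * (f * f)
  interchange = solve-∀ ℚ-ring

rhsKernel-zero≡wallis : ∀ n → rhsKernel 0 n * odd 0 n ≡ wallis n
rhsKernel-zero≡wallis zero    = refl
rhsKernel-zero≡wallis (suc n) = begin
  rhsKernel 0 n * (odd 0 n * t * (y * y)) * odd 0 (suc n)   ≡⟨ cong (rhsKernel 0 n * (odd 0 n * t * (y * y)) *_) (odd-suc 0 n) ⟩
  rhsKernel 0 n * (odd 0 n * t * (y * y)) * odd 1 n         ≡⟨ regroup (rhsKernel 0 n) (odd 0 n) t y (odd 1 n) ⟩
  rhsKernel 0 n * odd 0 n * (t * y) * (odd 1 n * y)         ≡⟨ cong₂ (λ w p → w * (t * y) * p) (rhsKernel-zero≡wallis n) (odd-inverse 1 n) ⟩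
  wallis n * (t * y) * 1ℚ                                   ≡⟨ *-identityʳ _ ⟩
  wallis n * (t * y)                                        ∎
  where
  open ≡-Reasoning
  t = 2 * fromℕ (suc n)
  y = 1/odd 1 n
  regroup : ∀ m a t y c → m * (a * t * (y * y)) * c ≡ m * a * (t * y) * (c * y)
  regroup = solve-∀ ℚ-ring

1/odd-antitone : ∀ n k → 1/odd n k ≤ 1/odd n 0
1/odd-antitone n k = inv-antitone (odd-pos n 0) (≤-from-slack (2 * fromℕ k) (2*-nonNeg (fromℕ-nonNeg k)) (reshape (fromℕ k) (fromℕ n)))
  where
  reshape : ∀ K N → 2 * K + 2 * N + 1 ≡ 2 * 0ℚ + 2 * N + 1 + 2 * K
  reshape = solve-∀ ℚ-ring

square-nonNeg : ∀ {x} → 0ℚ ≤ x → 0ℚ ≤ x * x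
square-nonNeg 0≤x = *-nonNeg 0≤x 0≤x

catalanRatio-nonNeg : ∀ n k → 0ℚ ≤ catalanRatio n k
catalanRatio-nonNeg n k = *-nonNeg (*-nonNeg (2*-nonNeg (fromℕ-nonNeg (suc n))) (<⇒≤ (odd-pos n k)))
                                   (square-nonNeg (1/odd-nonNeg (suc n) k))

catalanKernel-nonNeg : ∀ n k → 0ℚ ≤ catalanKernel n k
catalanKernel-nonNeg zero    k = square-nonNeg (1/odd-nonNeg 0 k)
catalanKernel-nonNeg (suc n) k = *-nonNeg (catalanKernel-nonNeg n k) (catalanRatio-nonNeg n k)

rhsRatio-nonNeg : ∀ n k → 0ℚ ≤ rhsRatio n k
rhsRatio-nonNeg n k = *-nonNeg (*-nonNeg (*-nonNeg (square-nonNeg (fromℕ-nonNeg (suc n)))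
  (+-nonNeg (+-nonNeg (2*-nonNeg (fromℕ-nonNeg k)) (fromℕ-nonNeg n)) (nonNegative⁻¹ 1ℚ)))
  (1/odd-nonNeg (suc n) 0)) (square-nonNeg (1/odd-nonNeg (suc n) k))

rhsKernel-nonNeg : ∀ n k → 0ℚ ≤ rhsKernel n k
rhsKernel-nonNeg zero    zero    = nonNegative⁻¹ 1ℚ
rhsKernel-nonNeg zero    (suc k) = *-nonNeg (rhsKernel-nonNeg 0 k)
  (*-nonNeg (*-nonNeg (<⇒≤ (odd-pos 0 k)) (2*-nonNeg (fromℕ-nonNeg (suc k)))) (square-nonNeg (1/odd-nonNeg 1 k)))
rhsKernel-nonNeg (suc n) k = *-nonNeg (rhsKernel-nonNeg n k) (rhsRatio-nonNeg n k)

rhsKernel-zero≤1/odd : ∀ k → rhsKernel 0 k ≤ 1/odd 0 k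
rhsKernel-zero≤1/odd k = begin
  rhsKernel 0 k                           ≡⟨ *-identityʳ (rhsKernel 0 k) ⟨
  rhsKernel 0 k * 1ℚ                      ≡⟨ cong (rhsKernel 0 k *_) (odd-inverse 0 k) ⟨
  rhsKernel 0 k * (odd 0 k * 1/odd 0 k)   ≡⟨ *-assoc (rhsKernel 0 k) (odd 0 k) (1/odd 0 k) ⟨
  rhsKernel 0 k * odd 0 k * 1/odd 0 k     ≡⟨ cong (_* 1/odd 0 k) (rhsKernel-zero≡wallis k) ⟩
  wallis k * 1/odd 0 k                    ≤⟨ *-monoʳ-≤ (1/odd 0 k) (1/odd-nonNeg 0 k) (wallis≤1 k) ⟩
  1ℚ * 1/odd 0 k                          ≡⟨ *-identityˡ (1/odd 0 k) ⟩
  1/odd 0 k                               ∎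
  where open ≤-Reasoning

rhsKernel-zero*suc≤wallis : ∀ m → rhsKernel 0 m * fromℕ (suc m) ≤ wallis m
rhsKernel-zero*suc≤wallis m = ≤-trans
  (*-monoˡ-≤ (rhsKernel 0 m) (rhsKernel-nonNeg 0 m) (≤-from-slack (fromℕ m) (fromℕ-nonNeg m) (reshape (fromℕ m))))
  (≤-reflexive (rhsKernel-zero≡wallis m))
  where
  reshape : ∀ M → 2 * M + 2 * 0ℚ + 1 ≡ 1ℚ + M + M
  reshape = solve-∀ ℚ-ring

catalanKernel≤ : ∀ n k → catalanKernel n k ≤ wallis n * 1/odd 0 k * 1/odd n k
catalanKernel≤ zero    k = ≤-reflexive (cong (_* 1/odd 0 k) (sym (*-identityˡ (1/odd 0 k))))
catalanKernel≤ (suc n) k = begin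
  catalanKernel n k * catalanRatio n k   ≤⟨ *-monoʳ-≤ (catalanRatio n k) (catalanRatio-nonNeg n k) (catalanKernel≤ n k) ⟩
  w * i * j * (t * b * (y * y))          ≡⟨ regroup w i j t b y ⟩
  w * t * i * y * y * (b * j)            ≡⟨ cong (w * t * i * y * y *_) (odd-inverse n k) ⟩
  w * t * i * y * y * 1ℚ                 ≡⟨ *-identityʳ _ ⟩
  w * t * i * y * y                      ≤⟨ *-monoˡ-≤ (w * t * i * y) wtiy-nonNeg y≤e ⟩
  w * t * i * y * e                      ≡⟨ regroup′ w t i y e ⟩
  w * (t * e) * i * y                    ∎
  where
  open ≤-Reasoning
  w = wallis n
  t = 2 * fromℕ (suc n)
  b = odd n k
  i = 1/odd 0 k
  j = 1/odd n k
  y = 1/odd (suc n) k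
  e = 1/odd 1 n
  y≤e : y ≤ e
  y≤e = ≤-trans (1/odd-antitone (suc n) k) (≤-reflexive (1/odd-corner n))
  wtiy-nonNeg : 0ℚ ≤ w * t * i * y
  wtiy-nonNeg = *-nonNeg (*-nonNeg (*-nonNeg (wallis-nonNeg n) (2*-nonNeg (fromℕ-nonNeg (suc n)))) (1/odd-nonNeg 0 k))
                         (1/odd-nonNeg (suc n) k)
  regroup : ∀ w i j t b y → w * i * j * (t * b * (y * y)) ≡ w * t * i * y * y * (b * j)
  regroup = solve-∀ ℚ-ring
  regroup′ : ∀ w t i y e → w * t * i * y * e ≡ w * (t * e) * i * y
  regroup′ = solve-∀ ℚ-ring

catalanRatio-step : ∀ n k → 1/suc n * catalanRatio n (suc k) ≤ 1/suc (suc (suc n))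
catalanRatio-step n k = ≤-by-clearing (u * (c * c) * u″) D>0 FL FR (suc-inverse n) (odd-inverse (suc n) (suc k))
  (suc-inverse (suc (suc n))) (cleared-lhs t b u u″ c h z) (cleared-rhs u u″ c h″)
  (≤-from-slack _ slack-nonNeg (certificate (fromℕ k) (fromℕ n)))
  where
  K = fromℕ k
  N = fromℕ n
  t = 2 * fromℕ (suc n)
  b = odd n (suc k)
  c = odd (suc n) (suc k)
  u = fromℕ (suc n)
  u″ = fromℕ (suc (suc (suc n)))
  h = 1/suc n
  h″ = 1/suc (suc (suc n))
  z = 1/odd (suc n) (suc k)
  D>0 : 0ℚ < u * (c * c) * u″
  D>0 = *-pos (*-pos (suc-pos n) (*-pos (odd-pos (suc n) (suc k)) (odd-pos (suc n) (suc k)))) (suc-pos (suc (suc n)))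
  FL FR : ℚ → ℚ → ℚ → ℚ
  FL p q r = t * b * u″ * p * (q * q)
  FR p q r = u * (c * c) * r
  cleared-lhs : ∀ t b u u″ c h z → h * (t * b * (z * z)) * (u * (c * c) * u″) ≡ t * b * u″ * (u * h) * ((c * z) * (c * z))
  cleared-lhs = solve-∀ ℚ-ring
  cleared-rhs : ∀ u u″ c h″ → h″ * (u * (c * c) * u″) ≡ u * (c * c) * (u″ * h″)
  cleared-rhs = solve-∀ ℚ-ring
  ℕ≥0 = fromℕ-nonNeg
  slack-nonNeg : 0ℚ ≤ (1ℚ + N) * (4 * K * K + 4 * K * N + 8 * K + 2 * N + 7)
  slack-nonNeg = *-nonNeg (ℕ≥0 (suc n)) (+-nonNeg (+-nonNeg (+-nonNeg (+-nonNeg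
    (*-nonNeg (*-nonNeg (nonNegative⁻¹ 4) (ℕ≥0 k)) (ℕ≥0 k)) (*-nonNeg (*-nonNeg (nonNegative⁻¹ 4) (ℕ≥0 k)) (ℕ≥0 n)))
    (*-nonNeg (nonNegative⁻¹ 8) (ℕ≥0 k))) (2*-nonNeg (ℕ≥0 n))) (nonNegative⁻¹ 7))
  certificate : ∀ K N → let B = 2 * (1ℚ + K) + 2 * N + 1 ; C = 2 * (1ℚ + K) + 2 * (1ℚ + N) + 1 in
    (1ℚ + N) * (C * C) * 1ℚ ≡ 2 * (1ℚ + N) * B * (1ℚ + (1ℚ + (1ℚ + N))) * 1ℚ * (1ℚ * 1ℚ)
                              + (1ℚ + N) * (4 * K * K + 4 * K * N + 8 * K + 2 * N + 7)
  certificate = solve-∀ ℚ-ring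

catalanKernel-suc≤ : ∀ n k → catalanKernel n (suc k) ≤ 1/odd 0 (suc k) * 1/odd 0 (suc k) * (2 * (1/suc n * 1/suc (suc n)))
catalanKernel-suc≤ zero    k = ≤-reflexive (sym (*-identityʳ _))
catalanKernel-suc≤ (suc n) k = begin
  catalanKernel n (suc k) * catalanRatio n (suc k)
      ≤⟨ *-monoʳ-≤ (catalanRatio n (suc k)) (catalanRatio-nonNeg n (suc k)) (catalanKernel-suc≤ n k) ⟩
  i′ * i′ * (2 * (h * h′)) * catalanRatio n (suc k)   ≡⟨ regroup i′ h h′ (catalanRatio n (suc k)) ⟩
  i′ * i′ * 2 * h′ * (h * catalanRatio n (suc k))     ≤⟨ *-monoˡ-≤ (i′ * i′ * 2 * h′) i′i′2h′-nonNeg (catalanRatio-step n k) ⟩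
  i′ * i′ * 2 * h′ * h″                               ≡⟨ regroup′ i′ h′ h″ ⟩
  i′ * i′ * (2 * (h′ * h″))                           ∎
  where
  open ≤-Reasoning
  i′ = 1/odd 0 (suc k)
  h = 1/suc n
  h′ = 1/suc (suc n)
  h″ = 1/suc (suc (suc n))
  i′i′2h′-nonNeg : 0ℚ ≤ i′ * i′ * 2 * h′
  i′i′2h′-nonNeg = *-nonNeg (*-nonNeg (square-nonNeg (1/odd-nonNeg 0 (suc k))) (nonNegative⁻¹ 2)) (1/suc-nonNeg (suc n))
  regroup : ∀ x a b ρ → x * x * (2 * (a * b)) * ρ ≡ x * x * 2 * b * (a * ρ)
  regroup = solve-∀ ℚ-ring
  regroup′ : ∀ x b c → x * x * 2 * b * c ≡ x * x * (2 * (b * c))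
  regroup′ = solve-∀ ℚ-ring

1/4 : ℚ
1/4 = inv 4

1/4^ : ℕ → ℚ
1/4^ zero    = 1ℚ
1/4^ (suc n) = 1/4^ n * 1/4

1/4^-nonNeg : ∀ n → 0ℚ ≤ 1/4^ n
1/4^-nonNeg zero    = nonNegative⁻¹ 1ℚ
1/4^-nonNeg (suc n) = *-nonNeg (1/4^-nonNeg n) (nonNegative⁻¹ 1/4)

rhsRatio≤1/4 : ∀ n k → rhsRatio n k ≤ 1/4
rhsRatio≤1/4 n k = ≤-by-clearing (c₀ * (c * c)) D>0 FL FR (odd-inverse (suc n) 0) (odd-inverse (suc n) k) refl
  (cleared-lhs u K N c₀ c e y) (cleared-rhs c₀ c)
  (≤-from-slack _ (*-nonNeg slack-nonNeg (nonNegative⁻¹ 1/4)) (certificate K N))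
  where
  K = fromℕ k
  N = fromℕ n
  u = fromℕ (suc n)
  c₀ = odd (suc n) 0
  c = odd (suc n) k
  e = 1/odd (suc n) 0
  y = 1/odd (suc n) k
  D>0 : 0ℚ < c₀ * (c * c)
  D>0 = *-pos (odd-pos (suc n) 0) (*-pos (odd-pos (suc n) k) (odd-pos (suc n) k))
  FL FR : ℚ → ℚ → ℚ → ℚ
  FL p q r = u * u * (2 * K + N + 1) * p * (q * q)
  FR p q r = 1/4 * c₀ * (c * c)
  cleared-lhs : ∀ u K N c₀ c e y → u * u * (2 * K + N + 1) * e * (y * y) * (c₀ * (c * c))
                                   ≡ u * u * (2 * K + N + 1) * (c₀ * e) * ((c * y) * (c * y))
  cleared-lhs = solve-∀ ℚ-ring
  cleared-rhs : ∀ c₀ c → 1/4 * (c₀ * (c * c)) ≡ 1/4 * c₀ * (c * c)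
  cleared-rhs = solve-∀ ℚ-ring
  ℕ≥0 = fromℕ-nonNeg
  lit = nonNegative⁻¹
  slack-nonNeg : 0ℚ ≤ 8 * K * K * N + 8 * K * N * N + 32 * K * N + 4 * N * N * N + 24 * N * N + 42 * N
                      + 12 * K * K + 28 * K + 23
  slack-nonNeg =
    +-nonNeg (+-nonNeg (+-nonNeg (+-nonNeg (+-nonNeg (+-nonNeg (+-nonNeg (+-nonNeg
      (*-nonNeg (*-nonNeg (*-nonNeg (lit 8) (ℕ≥0 k)) (ℕ≥0 k)) (ℕ≥0 n))
      (*-nonNeg (*-nonNeg (*-nonNeg (lit 8) (ℕ≥0 k)) (ℕ≥0 n)) (ℕ≥0 n)))
      (*-nonNeg (*-nonNeg (lit 32) (ℕ≥0 k)) (ℕ≥0 n)))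
      (*-nonNeg (*-nonNeg (*-nonNeg (lit 4) (ℕ≥0 n)) (ℕ≥0 n)) (ℕ≥0 n)))
      (*-nonNeg (*-nonNeg (lit 24) (ℕ≥0 n)) (ℕ≥0 n)))
      (*-nonNeg (lit 42) (ℕ≥0 n)))
      (*-nonNeg (*-nonNeg (lit 12) (ℕ≥0 k)) (ℕ≥0 k)))
      (*-nonNeg (lit 28) (ℕ≥0 k)))
      (lit 23)
  certificate : ∀ K N → let C₀ = 2 * 0ℚ + 2 * (1ℚ + N) + 1 ; C = 2 * K + 2 * (1ℚ + N) + 1 in
    1/4 * C₀ * (C * C) ≡ (1ℚ + N) * (1ℚ + N) * (2 * K + N + 1) * 1ℚ * (1ℚ * 1ℚ)
      + (8 * K * K * N + 8 * K * N * N + 32 * K * N + 4 * N * N * N + 24 * N * N + 42 * N + 12 * K * K + 28 * K + 23) * 1/4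
  certificate = solve-∀ ℚ-ring

rhsKernel-decay : ∀ j n k → rhsKernel (n ℕ.+ j) k ≤ rhsKernel j k * 1/4^ n
rhsKernel-decay j zero    k = ≤-reflexive (sym (*-identityʳ (rhsKernel j k)))
rhsKernel-decay j (suc n) k = begin
  rhsKernel (n ℕ.+ j) k * rhsRatio (n ℕ.+ j) k
      ≤⟨ *-monoʳ-≤ (rhsRatio (n ℕ.+ j) k) (rhsRatio-nonNeg (n ℕ.+ j) k) (rhsKernel-decay j n k) ⟩
  rhsKernel j k * 1/4^ n * rhsRatio (n ℕ.+ j) k
      ≤⟨ *-monoˡ-≤ (rhsKernel j k * 1/4^ n) (*-nonNeg (rhsKernel-nonNeg j k) (1/4^-nonNeg n)) (rhsRatio≤1/4 (n ℕ.+ j) k) ⟩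
  rhsKernel j k * 1/4^ n * 1/4   ≡⟨ *-assoc (rhsKernel j k) (1/4^ n) 1/4 ⟩
  rhsKernel j k * 1/4^ (suc n)   ∎
  where open ≤-Reasoning

rhsKernel-one≤ : ∀ k → rhsKernel 1 k ≤ 1/odd 0 k - 1/odd 0 (suc k)
rhsKernel-one≤ k = begin
  rhsKernel 0 k * rhsRatio 0 k   ≤⟨ *-monoʳ-≤ (rhsRatio 0 k) (rhsRatio-nonNeg 0 k) (rhsKernel-zero≤1/odd k) ⟩
  i * rhsRatio 0 k               ≤⟨ ≤-by-clearing (a * (c * c)) D>0 FL FR (odd-inverse 0 k) (odd-inverse 1 k) refl
                                      (cleared-lhs i K a c e y) (cleared-rhs i y a c)
                                      (≤-from-slack _ slack-nonNeg (certificate K)) ⟩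
  i - y                          ≡⟨ cong (λ x → i - x) (1/odd-suc 0 k) ⟨
  i - 1/odd 0 (suc k)            ∎
  where
  open ≤-Reasoning
  K = fromℕ k
  a = odd 0 k
  c = odd 1 k
  i = 1/odd 0 k
  e = 1/odd 1 0
  y = 1/odd 1 k
  D>0 : 0ℚ < a * (c * c)
  D>0 = *-pos (odd-pos 0 k) (*-pos (odd-pos 1 k) (odd-pos 1 k))
  FL FR : ℚ → ℚ → ℚ → ℚ
  FL p q r = (2 * K + 0ℚ + 1) * e * p * (q * q)
  FR p q r = p * (c * c) - a * c * q
  cleared-lhs : ∀ i K a c e y → i * ((1ℚ + 0ℚ) * (1ℚ + 0ℚ) * (2 * K + 0ℚ + 1) * e * (y * y)) * (a * (c * c))
                                ≡ (2 * K + 0ℚ + 1) * e * (a * i) * ((c * y) * (c * y))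
  cleared-lhs = solve-∀ ℚ-ring
  cleared-rhs : ∀ i y a c → (i - y) * (a * (c * c)) ≡ (a * i) * (c * c) - a * c * (c * y)
  cleared-rhs = solve-∀ ℚ-ring
  slack-nonNeg : 0ℚ ≤ (10 * K + 17) * e
  slack-nonNeg = *-nonNeg (+-nonNeg (*-nonNeg (nonNegative⁻¹ 10) (fromℕ-nonNeg k)) (nonNegative⁻¹ 17)) (1/odd-nonNeg 1 0)
  certificate : ∀ K → let A = 2 * K + 2 * 0ℚ + 1 ; C = 2 * K + 2 * (1ℚ + 0ℚ) + 1 in
    1ℚ * (C * C) - A * C * 1ℚ ≡ (2 * K + 0ℚ + 1) * e * 1ℚ * (1ℚ * 1ℚ) + (10 * K + 17) * e
  certificate = solve-∀ ℚ-ring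

1/odd²≤Δ : ∀ k → 1/odd 0 k * 1/odd 0 k ≤ 2 * 1/suc k - 2 * 1/suc (suc k)
1/odd²≤Δ k = ≤-by-clearing (a * a * u * u′) D>0 FL FR (odd-inverse 0 k) (suc-inverse k) (suc-inverse (suc k))
  (cleared-lhs a u u′ i) (cleared-rhs a u u′ h h′)
  (≤-from-slack _ slack-nonNeg (certificate K))
  where
  K = fromℕ k
  a = odd 0 k
  u = fromℕ (suc k)
  u′ = fromℕ (suc (suc k))
  i = 1/odd 0 k
  h = 1/suc k
  h′ = 1/suc (suc k)
  D>0 : 0ℚ < a * a * u * u′
  D>0 = *-pos (*-pos (*-pos (odd-pos 0 k) (odd-pos 0 k)) (suc-pos k)) (suc-pos (suc k))
  FL FR : ℚ → ℚ → ℚ → ℚ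
  FL p q r = u * u′ * (p * p)
  FR p q r = 2 * a * a * u′ * q - 2 * a * a * u * r
  cleared-lhs : ∀ a u u′ i → i * i * (a * a * u * u′) ≡ u * u′ * ((a * i) * (a * i))
  cleared-lhs = solve-∀ ℚ-ring
  cleared-rhs : ∀ a u u′ h h′ → (2 * h - 2 * h′) * (a * a * u * u′) ≡ 2 * a * a * u′ * (u * h) - 2 * a * a * u * (u′ * h′)
  cleared-rhs = solve-∀ ℚ-ring
  slack-nonNeg : 0ℚ ≤ 7 * K * K + 5 * K
  slack-nonNeg = +-nonNeg (*-nonNeg (*-nonNeg (nonNegative⁻¹ 7) (fromℕ-nonNeg k)) (fromℕ-nonNeg k))
                          (*-nonNeg (nonNegative⁻¹ 5) (fromℕ-nonNeg k))
  certificate : ∀ K → let A = 2 * K + 2 * 0ℚ + 1 in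
    2 * A * A * (1ℚ + (1ℚ + K)) * 1ℚ - 2 * A * A * (1ℚ + K) * 1ℚ ≡ (1ℚ + K) * (1ℚ + (1ℚ + K)) * (1ℚ * 1ℚ) + (7 * K * K + 5 * K)
  certificate = solve-∀ ℚ-ring

2/suc-nonNeg : ∀ k → 0ℚ ≤ 2 * 1/suc k
2/suc-nonNeg k = 2*-nonNeg (1/suc-nonNeg k)

∑1/odd²≤2 : ∀ n → partial (λ k → 1/odd 0 k * 1/odd 0 k) n ≤ 2
∑1/odd²≤2 = partial≤ (λ k → 2 * 1/suc k) 1/odd²≤Δ 2/suc-nonNeg

2/suc*suc≤Δ : ∀ j → 2 * (1/suc j * 1/suc (suc j)) ≤ 2 * 1/suc j - 2 * 1/suc (suc j)
2/suc*suc≤Δ j = ≤-by-clearing (u * u′) (*-pos (suc-pos j) (suc-pos (suc j))) FL FR (suc-inverse j) (suc-inverse (suc j)) refl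
  (cleared-lhs u u′ h h′) (cleared-rhs u u′ h h′) (≤-reflexive (certificate (fromℕ j)))
  where
  u = fromℕ (suc j)
  u′ = fromℕ (suc (suc j))
  h = 1/suc j
  h′ = 1/suc (suc j)
  FL FR : ℚ → ℚ → ℚ → ℚ
  FL p q r = 2 * p * q
  FR p q r = 2 * u′ * p - 2 * u * q
  cleared-lhs : ∀ u u′ h h′ → 2 * (h * h′) * (u * u′) ≡ 2 * (u * h) * (u′ * h′)
  cleared-lhs = solve-∀ ℚ-ring
  cleared-rhs : ∀ u u′ h h′ → (2 * h - 2 * h′) * (u * u′) ≡ 2 * u′ * (u * h) - 2 * u * (u′ * h′)
  cleared-rhs = solve-∀ ℚ-ring
  certificate : ∀ J → 2 * 1ℚ * 1ℚ ≡ 2 * (1ℚ + (1ℚ + J)) * 1ℚ - 2 * (1ℚ + J) * 1ℚ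
  certificate = solve-∀ ℚ-ring

∑2/suc*suc≤2 : ∀ m → partial (λ j → 2 * (1/suc j * 1/suc (suc j))) m ≤ 2
∑2/suc*suc≤2 = partial≤ (λ k → 2 * 1/suc k) 2/suc*suc≤Δ 2/suc-nonNeg

∑[2n+1]/4^n≤3 : ∀ n → partial (λ j → (2 * fromℕ j + 1) * 1/4^ j) n ≤ 3
∑[2n+1]/4^n≤3 = partial≤ (λ j → (3 * fromℕ j + 3) * 1/4^ j) step
  (λ j → *-nonNeg (+-nonNeg (*-nonNeg (nonNegative⁻¹ 3) (fromℕ-nonNeg j)) (nonNegative⁻¹ 3)) (1/4^-nonNeg j))
  where
  step : ∀ j → (2 * fromℕ j + 1) * 1/4^ j ≤ (3 * fromℕ j + 3) * 1/4^ j - (3 * fromℕ (suc j) + 3) * 1/4^ (suc j)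
  step j = ≤-from-slack _ (*-nonNeg (*-nonNeg (+-nonNeg (fromℕ-nonNeg j) (nonNegative⁻¹ 2)) (1/4^-nonNeg j)) (nonNegative⁻¹ 1/4))
                        (certificate (fromℕ j) (1/4^ j))
    where
    certificate : ∀ J q → (3 * J + 3) * q - (3 * (1ℚ + J) + 3) * (q * 1/4) ≡ (2 * J + 1) * q + (J + 2) * q * 1/4
    certificate = solve-∀ ℚ-ring

∑rhsKernel-one≤1 : ∀ m → partial (rhsKernel 1) m ≤ 1ℚ
∑rhsKernel-one≤1 = partial≤ (1/odd 0) rhsKernel-one≤ (1/odd-nonNeg 0)

1/4^*suc²≤1 : ∀ n → 1/4^ n * (fromℕ (suc n) * fromℕ (suc n)) ≤ 1ℚ
1/4^*suc²≤1 zero    = ≤-refl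
1/4^*suc²≤1 (suc n) = begin
  1/4^ n * 1/4 * (u′ * u′)      ≡⟨ *-assoc (1/4^ n) 1/4 (u′ * u′) ⟩
  1/4^ n * (1/4 * (u′ * u′))    ≤⟨ *-monoˡ-≤ (1/4^ n) (1/4^-nonNeg n) (≤-from-slack _ slack-nonNeg (certificate (fromℕ n))) ⟩
  1/4^ n * (u * u)              ≤⟨ 1/4^*suc²≤1 n ⟩
  1ℚ                            ∎
  where
  open ≤-Reasoning
  N = fromℕ n
  u = fromℕ (suc n)
  u′ = fromℕ (suc (suc n))
  slack-nonNeg : 0ℚ ≤ (3 * N * N + 4 * N) * 1/4
  slack-nonNeg = *-nonNeg (+-nonNeg (*-nonNeg (*-nonNeg (nonNegative⁻¹ 3) (fromℕ-nonNeg n)) (fromℕ-nonNeg n))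
                                    (*-nonNeg (nonNegative⁻¹ 4) (fromℕ-nonNeg n))) (nonNegative⁻¹ 1/4)
  certificate : ∀ N → (1ℚ + N) * (1ℚ + N) ≡ 1/4 * ((1ℚ + (1ℚ + N)) * (1ℚ + (1ℚ + N))) + (3 * N * N + 4 * N) * 1/4
  certificate = solve-∀ ℚ-ring

suc*1/4^≤1/suc : ∀ n → fromℕ (suc n) * 1/4^ n ≤ 1/suc n
suc*1/4^≤1/suc n = begin
  u * q                   ≡⟨ *-identityʳ (u * q) ⟨
  u * q * 1ℚ              ≡⟨ cong (u * q *_) (suc-inverse n) ⟨
  u * q * (u * h)         ≡⟨ regroup u q h ⟩
  q * (u * u) * h         ≤⟨ *-monoʳ-≤ h (1/suc-nonNeg n) (1/4^*suc²≤1 n) ⟩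
  1ℚ * h                  ≡⟨ *-identityˡ h ⟩
  h                       ∎
  where
  open ≤-Reasoning
  u = fromℕ (suc n)
  q = 1/4^ n
  h = 1/suc n
  regroup : ∀ u q h → u * q * (u * h) ≡ q * (u * u) * h
  regroup = solve-∀ ℚ-ring

∣sign∣ : ∀ k → ∣ sign k ∣ ≡ 1ℚ
∣sign∣ zero    = refl
∣sign∣ (suc k) = trans (∣-p∣≡∣p∣ (sign k)) (∣sign∣ k)

∣sign*∣ : ∀ k x → ∣ sign k * x ∣ ≡ ∣ x ∣
∣sign*∣ k x = trans (∣p*q∣≡∣p∣*∣q∣ (sign k) x) (trans (cong (_* ∣ x ∣) (∣sign∣ k)) (*-identityˡ ∣ x ∣))

∣sign**∣ : ∀ k {m t} → 0ℚ ≤ m → 0ℚ ≤ t → ∣ sign k * m * t ∣ ≡ m * t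
∣sign**∣ k {m} {t} 0≤m 0≤t = trans (cong ∣_∣ (*-assoc (sign k) m t)) (trans (∣sign*∣ k (m * t)) (0≤p⇒∣p∣≡p (*-nonNeg 0≤m 0≤t)))

∣catalanG∣≤ : ∀ m k → ∣ catalanG m k ∣ ≤ 2 * wallis m * (1/odd 0 k * 1/odd 0 k)
∣catalanG∣≤ m k = begin
  ∣ catalanG m k ∣                 ≡⟨ ∣sign**∣ k (catalanKernel-nonNeg m k) t-nonNeg ⟩
  catalanKernel m k * t            ≤⟨ *-monoʳ-≤ t t-nonNeg (catalanKernel≤ m k) ⟩
  wallis m * i * j * t             ≡⟨ regroup (wallis m) i j (fromℕ k) (fromℕ m) ⟩
  X * ((2 * fromℕ k + fromℕ m + 1) * j)
                                   ≤⟨ *-monoˡ-≤ X X-nonNeg (≤-trans (*-monoʳ-≤ j (1/odd-nonNeg m k) ≤odd) (≤-reflexive (odd-inverse m k))) ⟩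
  X * 1ℚ                           ≡⟨ *-identityʳ X ⟩
  X                                ∎
  where
  open ≤-Reasoning
  i = 1/odd 0 k
  j = 1/odd m k
  t = 2 * (2 * fromℕ k + fromℕ m + 1) * i
  X = 2 * wallis m * (i * i)
  t-nonNeg : 0ℚ ≤ t
  t-nonNeg = *-nonNeg (2*-nonNeg (+-nonNeg (+-nonNeg (2*-nonNeg (fromℕ-nonNeg k)) (fromℕ-nonNeg m)) (nonNegative⁻¹ 1ℚ)))
                      (1/odd-nonNeg 0 k)
  X-nonNeg : 0ℚ ≤ X
  X-nonNeg = *-nonNeg (2*-nonNeg (wallis-nonNeg m)) (square-nonNeg (1/odd-nonNeg 0 k))
  ≤odd : 2 * fromℕ k + fromℕ m + 1 ≤ odd m k
  ≤odd = ≤-from-slack (fromℕ m) (fromℕ-nonNeg m) (reshape (fromℕ k) (fromℕ m))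
    where
    reshape : ∀ K M → 2 * K + 2 * M + 1 ≡ 2 * K + M + 1 + M
    reshape = solve-∀ ℚ-ring
  regroup : ∀ w i j K M → w * i * j * (2 * (2 * K + M + 1) * i) ≡ 2 * w * (i * i) * ((2 * K + M + 1) * j)
  regroup = solve-∀ ℚ-ring

∣catalanF∣≤ : ∀ j n → ∣ catalanF j (suc n) ∣ ≤ 1/odd 0 (suc n) * 1/odd 0 (suc n) * (2 * (1/suc j * 1/suc (suc j)))
∣catalanF∣≤ j n = ≤-trans (≤-reflexive (trans (∣sign*∣ (suc n) (catalanKernel j (suc n)))
                                              (0≤p⇒∣p∣≡p (catalanKernel-nonNeg j (suc n)))))
                          (catalanKernel-suc≤ j n)

∣rhsF∣≤ : ∀ j m → ∣ rhsF j m ∣ ≤ rhsKernel 0 m * (4 * fromℕ m + 4) * ((2 * fromℕ j + 1) * 1/4^ j)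
∣rhsF∣≤ j m = begin
  ∣ rhsF j m ∣                                          ≡⟨ ∣sign**∣ j (rhsKernel-nonNeg j m) t-nonNeg ⟩
  rhsKernel j m * t                                     ≤⟨ *-monoʳ-≤ t t-nonNeg kernel≤ ⟩
  rhsKernel 0 m * 1/4^ j * t                            ≤⟨ *-monoˡ-≤ (rhsKernel 0 m * 1/4^ j)
                                                             (*-nonNeg (rhsKernel-nonNeg 0 m) (1/4^-nonNeg j))
                                                             (≤-from-slack _ slack-nonNeg (certificate J M)) ⟩
  rhsKernel 0 m * 1/4^ j * ((4 * M + 4) * (2 * J + 1))  ≡⟨ regroup (rhsKernel 0 m) (1/4^ j) J M ⟩
  rhsKernel 0 m * (4 * M + 4) * ((2 * J + 1) * 1/4^ j)  ∎
  where
  open ≤-Reasoning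
  J = fromℕ j
  M = fromℕ m
  t = 6 * J + 4 * M + 4
  t-nonNeg : 0ℚ ≤ t
  t-nonNeg = +-nonNeg (+-nonNeg (*-nonNeg (nonNegative⁻¹ 6) (fromℕ-nonNeg j)) (*-nonNeg (nonNegative⁻¹ 4) (fromℕ-nonNeg m)))
                      (nonNegative⁻¹ 4)
  kernel≤ : rhsKernel j m ≤ rhsKernel 0 m * 1/4^ j
  kernel≤ = subst (λ x → rhsKernel x m ≤ rhsKernel 0 m * 1/4^ j) (ℕ.+-identityʳ j) (rhsKernel-decay 0 j m)
  slack-nonNeg : 0ℚ ≤ 8 * M * J + 2 * J
  slack-nonNeg = +-nonNeg (*-nonNeg (*-nonNeg (nonNegative⁻¹ 8) (fromℕ-nonNeg m)) (fromℕ-nonNeg j)) (2*-nonNeg (fromℕ-nonNeg j))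
  certificate : ∀ J M → (4 * M + 4) * (2 * J + 1) ≡ 6 * J + 4 * M + 4 + (8 * M * J + 2 * J)
  certificate = solve-∀ ℚ-ring
  regroup : ∀ p q J M → p * q * ((4 * M + 4) * (2 * J + 1)) ≡ p * (4 * M + 4) * ((2 * J + 1) * q)
  regroup = solve-∀ ℚ-ring

∣rhsG∣≤ : ∀ n k → ∣ rhsG (suc n) k ∣ ≤ 1/4^ n * (4 * fromℕ (suc n) + 2) * rhsKernel 1 k
∣rhsG∣≤ n k = begin
  ∣ rhsG (suc n) k ∣                 ≡⟨ ∣sign**∣ (suc n) (rhsKernel-nonNeg (suc n) k) t-nonNeg ⟩
  rhsKernel (suc n) k * t            ≤⟨ *-monoʳ-≤ t t-nonNeg kernel≤ ⟩
  rhsKernel 1 k * 1/4^ n * t         ≡⟨ regroup (rhsKernel 1 k) (1/4^ n) t ⟩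
  1/4^ n * t * rhsKernel 1 k         ∎
  where
  open ≤-Reasoning
  t = 4 * fromℕ (suc n) + 2
  t-nonNeg : 0ℚ ≤ t
  t-nonNeg = +-nonNeg (*-nonNeg (nonNegative⁻¹ 4) (fromℕ-nonNeg (suc n))) (nonNegative⁻¹ 2)
  kernel≤ : rhsKernel (suc n) k ≤ rhsKernel 1 k * 1/4^ n
  kernel≤ = subst (λ x → rhsKernel x k ≤ rhsKernel 1 k * 1/4^ n) (ℕ.+-comm n 1) (rhsKernel-decay 1 n k)
  regroup : ∀ a q t → a * q * t ≡ q * t * a
  regroup = solve-∀ ℚ-ring

1/odd-suc≤1/suc : ∀ n → 1/odd 0 (suc n) ≤ 1/suc n
1/odd-suc≤1/suc n = inv-antitone (suc-pos n) (≤-from-slack (fromℕ n + 2) (+-nonNeg (fromℕ-nonNeg n) (nonNegative⁻¹ 2))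
                                                           (reshape (fromℕ n)))
  where
  reshape : ∀ N → 2 * (1ℚ + N) + 2 * 0ℚ + 1 ≡ 1ℚ + N + (N + 2)
  reshape = solve-∀ ℚ-ring

∣2a-2b-c+d∣≤ : ∀ a b c d → ∣ 2 * a - 2 * b - c + d ∣ ≤ 2 * ∣ a ∣ + 2 * ∣ b ∣ + ∣ c ∣ + ∣ d ∣
∣2a-2b-c+d∣≤ a b c d = begin
  ∣ 2 * a - 2 * b - c + d ∣              ≤⟨ ∣p+q∣≤∣p∣+∣q∣ (2 * a - 2 * b - c) d ⟩
  ∣ 2 * a - 2 * b - c ∣ + ∣ d ∣          ≤⟨ +-monoˡ-≤ ∣ d ∣ (∣p-q∣≤∣p∣+∣q∣ (2 * a - 2 * b) c) ⟩
  ∣ 2 * a - 2 * b ∣ + ∣ c ∣ + ∣ d ∣      ≤⟨ +-monoˡ-≤ ∣ d ∣ (+-monoˡ-≤ ∣ c ∣ (∣p-q∣≤∣p∣+∣q∣ (2 * a) (2 * b))) ⟩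
  ∣ 2 * a ∣ + ∣ 2 * b ∣ + ∣ c ∣ + ∣ d ∣  ≡⟨ cong₂ (λ x y → x + y + ∣ c ∣ + ∣ d ∣) (∣p*q∣≡∣p∣*∣q∣ 2 a) (∣p*q∣≡∣p∣*∣q∣ 2 b) ⟩
  2 * ∣ a ∣ + 2 * ∣ b ∣ + ∣ c ∣ + ∣ d ∣  ∎
  where open ≤-Reasoning

-- The column index m is free: the edge sums depending on m are O(wallis m), the others O(1/n).
catalan-rhs-error : ∀ n m → 4 * ∣ partial catalanTerm (suc n) - partial rhsTerm (suc n) ∣ ≤ 20 * wallis m + 10 * 1/suc n
catalan-rhs-error n m = begin
  4 * ∣ C - R ∣                              ≡⟨ ∣p*q∣≡∣p∣*∣q∣ 4 (C - R) ⟨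
  ∣ 4 * (C - R) ∣                            ≡⟨ cong ∣_∣ (catalan-rhs-identity (suc n) m) ⟩
  ∣ 2 * Y₁ - 2 * X₁ - X₂ + Y₂ ∣              ≤⟨ ∣2a-2b-c+d∣≤ Y₁ X₁ X₂ Y₂ ⟩
  2 * ∣ Y₁ ∣ + 2 * ∣ X₁ ∣ + ∣ X₂ ∣ + ∣ Y₂ ∣  ≤⟨ +-mono-≤ (+-mono-≤ (+-mono-≤ (*-monoˡ-≤ 2 (nonNegative⁻¹ 2) ∣Y₁∣≤)
                                                                           (*-monoˡ-≤ 2 (nonNegative⁻¹ 2) ∣X₁∣≤))
                                                                 ∣X₂∣≤) ∣Y₂∣≤ ⟩
  2 * (4 * w) + 2 * (2 * h) + 12 * w + 6 * h ≡⟨ collect w h ⟩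
  20 * w + 10 * h                            ∎
  where
  open ≤-Reasoning
  C = partial catalanTerm (suc n)
  R = partial rhsTerm (suc n)
  Y₁ = partial (catalanG m) (suc n)
  X₁ = partial (λ j → catalanF j (suc n)) m
  X₂ = partial (λ j → rhsF j m) (suc n)
  Y₂ = partial (rhsG (suc n)) m
  w = wallis m
  h = 1/suc n
  N = fromℕ n
  M = fromℕ m
  i′ = 1/odd 0 (suc n)
  q = 1/4^ n
  ∣Y₁∣≤ : ∣ Y₁ ∣ ≤ 4 * w
  ∣Y₁∣≤ = ≤-trans (∣partial∣≤-scaled (2 * w) 2 (2*-nonNeg (wallis-nonNeg m)) (∣catalanG∣≤ m) (suc n) (∑1/odd²≤2 (suc n)))
                  (≤-reflexive (regroup w))
    where
    regroup : ∀ w → 2 * w * 2 ≡ 4 * w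
    regroup = solve-∀ ℚ-ring
  ∣X₁∣≤ : ∣ X₁ ∣ ≤ 2 * h
  ∣X₁∣≤ = begin
    ∣ X₁ ∣          ≤⟨ ∣partial∣≤-scaled (i′ * i′) 2 (square-nonNeg (1/odd-nonNeg 0 (suc n))) (λ j → ∣catalanF∣≤ j n) m (∑2/suc*suc≤2 m) ⟩
    i′ * i′ * 2     ≤⟨ *-monoʳ-≤ 2 (nonNegative⁻¹ 2) (*-monoˡ-≤ i′ (1/odd-nonNeg 0 (suc n)) (1/odd≤1 0 (suc n))) ⟩
    i′ * 1ℚ * 2     ≡⟨ cong (_* 2) (*-identityʳ i′) ⟩
    i′ * 2          ≤⟨ *-monoʳ-≤ 2 (nonNegative⁻¹ 2) (1/odd-suc≤1/suc n) ⟩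
    h * 2           ≡⟨ *-comm h 2 ⟩
    2 * h           ∎
  ∣X₂∣≤ : ∣ X₂ ∣ ≤ 12 * w
  ∣X₂∣≤ = begin
    ∣ X₂ ∣                                 ≤⟨ ∣partial∣≤-scaled (rhsKernel 0 m * (4 * M + 4)) 3 c-nonNeg (λ j → ∣rhsF∣≤ j m) (suc n) (∑[2n+1]/4^n≤3 (suc n)) ⟩
    rhsKernel 0 m * (4 * M + 4) * 3        ≡⟨ regroup (rhsKernel 0 m) M ⟩
    12 * (rhsKernel 0 m * fromℕ (suc m))   ≤⟨ *-monoˡ-≤ 12 (nonNegative⁻¹ 12) (rhsKernel-zero*suc≤wallis m) ⟩
    12 * w                                 ∎
    where
    c-nonNeg : 0ℚ ≤ rhsKernel 0 m * (4 * M + 4)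
    c-nonNeg = *-nonNeg (rhsKernel-nonNeg 0 m) (+-nonNeg (*-nonNeg (nonNegative⁻¹ 4) (fromℕ-nonNeg m)) (nonNegative⁻¹ 4))
    regroup : ∀ p M → p * (4 * M + 4) * 3 ≡ 12 * (p * (1ℚ + M))
    regroup = solve-∀ ℚ-ring
  ∣Y₂∣≤ : ∣ Y₂ ∣ ≤ 6 * h
  ∣Y₂∣≤ = begin
    ∣ Y₂ ∣                                 ≤⟨ ∣partial∣≤-scaled (q * (4 * fromℕ (suc n) + 2)) 1ℚ c-nonNeg (∣rhsG∣≤ n) m (∑rhsKernel-one≤1 m) ⟩
    q * (4 * fromℕ (suc n) + 2) * 1ℚ       ≤⟨ ≤-from-slack _ (2*-nonNeg (*-nonNeg (fromℕ-nonNeg n) (1/4^-nonNeg n))) (certificate q N) ⟩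
    6 * (fromℕ (suc n) * q)                ≤⟨ *-monoˡ-≤ 6 (nonNegative⁻¹ 6) (suc*1/4^≤1/suc n) ⟩
    6 * h                                  ∎
    where
    c-nonNeg : 0ℚ ≤ q * (4 * fromℕ (suc n) + 2)
    c-nonNeg = *-nonNeg (1/4^-nonNeg n) (+-nonNeg (*-nonNeg (nonNegative⁻¹ 4) (fromℕ-nonNeg (suc n))) (nonNegative⁻¹ 2))
    certificate : ∀ q N → 6 * ((1ℚ + N) * q) ≡ q * (4 * (1ℚ + N) + 2) * 1ℚ + 2 * (N * q)
    certificate = solve-∀ ℚ-ring
  collect : ∀ w h → 2 * (4 * w) + 2 * (2 * h) + 12 * w + 6 * h ≡ 20 * w + 10 * h
  collect = solve-∀ ℚ-ring

-- Convergence

IsCauchy : (ℕ → ℚ) → Set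
IsCauchy a = (ε : ℚ) → Positive ε → Σ ℕ λ N → (m n : ℕ) → m ≥ N → n ≥ N → ∣ a m - a n ∣ < ε

TendsToZero : (ℕ → ℚ) → Set
TendsToZero a = (ε : ℚ) → Positive ε → Σ ℕ λ N → (n : ℕ) → n ≥ N → ∣ a n ∣ < ε

1/suc≤pos : ∀ ε → 0ℚ < ε → Σ ℕ λ q → 1/suc q ≤ ε
1/suc≤pos (mkℚ (+ zero)  q _) (*<* (ℤ.+<+ ()))
1/suc≤pos (mkℚ -[1+ p ] q _) (*<* ())
1/suc≤pos ε@(mkℚ (+ suc p) q _) _ = q , (begin
  1/suc q                               ≡⟨ *-identityˡ (1/suc q) ⟨
  1ℚ * 1/suc q                          ≤⟨ *-monoʳ-≤ (1/suc q) (1/suc-nonNeg q) 1≤1+p ⟩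
  fromℕ (suc p) * 1/suc q               ≡⟨ cong (_* 1/suc q) ε*[1+q]≡1+p ⟨
  ε * fromℕ (suc q) * 1/suc q           ≡⟨ *-assoc ε (fromℕ (suc q)) (1/suc q) ⟩
  ε * (fromℕ (suc q) * 1/suc q)         ≡⟨ cong (ε *_) (suc-inverse q) ⟩
  ε * 1ℚ                                ≡⟨ *-identityʳ ε ⟩
  ε                                     ∎)
  where
  open ≤-Reasoning
  ε*[1+q]≡1+p : ε * fromℕ (suc q) ≡ fromℕ (suc p)
  ε*[1+q]≡1+p = trans (cong (_* fromℕ (suc q)) (sym (↥p/↧p≡p ε))) (/′-*-denominator (+ suc p) (suc q) ℕ.z<s)
  1≤1+p : 1ℚ ≤ fromℕ (suc p)
  1≤1+p = ≤-from-slack (fromℕ p) (fromℕ-nonNeg p) refl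

c/suc-eventually< : ∀ c ε → 0ℚ < ε → Σ ℕ λ K → ∀ n → n ≥ K → fromℕ c * 1/suc n < ε
c/suc-eventually< c ε 0<ε with 1/suc≤pos ε 0<ε
... | q , 1/suc[q]≤ε = c ℕ.* suc q , λ n n≥K → <-≤-trans (c/suc[n]<1/suc[q] n n≥K) 1/suc[q]≤ε
  where
  c/suc[n]<1/suc[q] : ∀ n → c ℕ.* suc q ℕ.≤ n → fromℕ c * 1/suc n < 1/suc q
  c/suc[n]<1/suc[q] n c[1+q]≤n =
    *-cancelʳ-<-nonNeg (u * v) {{nonNegative (<⇒≤ (*-pos (suc-pos n) (suc-pos q)))}} (begin-strict
      fromℕ c * h * (u * v)      ≡⟨ regroup (fromℕ c) h u v ⟩
      fromℕ c * v * (u * h)      ≡⟨ cong₂ _*_ (sym (fromℕ-* c (suc q))) (suc-inverse n) ⟩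
      fromℕ (c ℕ.* suc q) * 1ℚ   ≡⟨ *-identityʳ _ ⟩
      fromℕ (c ℕ.* suc q)        ≤⟨ fromℕ-mono-≤ c[1+q]≤n ⟩
      fromℕ n                    <⟨ n<1+n ⟩
      u                          ≡⟨ *-identityʳ u ⟨
      u * 1ℚ                     ≡⟨ cong (u *_) (suc-inverse q) ⟨
      u * (v * h′)               ≡⟨ regroup′ u v h′ ⟩
      h′ * (u * v)               ∎)
    where
    open ≤-Reasoning
    u = fromℕ (suc n)
    v = fromℕ (suc q)
    h = 1/suc n
    h′ = 1/suc q
    n<1+n : fromℕ n < 1ℚ + fromℕ n
    n<1+n = subst (_< 1ℚ + fromℕ n) (+-identityˡ (fromℕ n)) (+-monoˡ-< (fromℕ n) (positive⁻¹ 1ℚ))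
    regroup : ∀ c h u v → c * h * (u * v) ≡ c * v * (u * h)
    regroup = solve-∀ ℚ-ring
    regroup′ : ∀ u v h′ → u * (v * h′) ≡ h′ * (u * v)
    regroup′ = solve-∀ ℚ-ring

square-<⇒≤ : ∀ {x δ} → 0ℚ ≤ x → 0ℚ < δ → x * x < δ * δ → x ≤ δ
square-<⇒≤ {x} {δ} 0≤x 0<δ x²<δ² with x ≤? δ
... | yes x≤δ = x≤δ
... | no x≰δ  = ⊥-elim (<-irrefl refl (<-≤-trans x²<δ² δ²≤x²))
  where
  δ≤x : δ ≤ x
  δ≤x = <⇒≤ (≰⇒> x≰δ)
  δ²≤x² : δ * δ ≤ x * x
  δ²≤x² = ≤-trans (*-monoˡ-≤ δ (<⇒≤ 0<δ) δ≤x) (*-monoʳ-≤ x 0≤x δ≤x)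

wallis-eventually≤ : ∀ δ → 0ℚ < δ → Σ ℕ λ M → wallis M ≤ δ
wallis-eventually≤ δ 0<δ = M , square-<⇒≤ (wallis-nonNeg M) 0<δ (≤-<-trans (wallis²≤1/suc M) 1/suc[M]<δ²)
  where
  small : Σ ℕ λ K → ∀ n → n ≥ K → fromℕ 1 * 1/suc n < δ * δ
  small = c/suc-eventually< 1 (δ * δ) (*-pos 0<δ 0<δ)
  M = proj₁ small
  1/suc[M]<δ² : 1/suc M < δ * δ
  1/suc[M]<δ² = subst (_< δ * δ) (*-identityˡ (1/suc M))
                      (subst (λ c → c * 1/suc M < δ * δ) {fromℕ 1} {1ℚ} refl (proj₂ small M ℕ.≤-refl))

∣p-q∣≡∣q-p∣ : ∀ p q → ∣ p - q ∣ ≡ ∣ q - p ∣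
∣p-q∣≡∣q-p∣ p q = trans (sym (∣-p∣≡∣p∣ (p - q))) (cong ∣_∣ (negate p q))
  where
  negate : ∀ p q → - (p - q) ≡ q - p
  negate = solve-∀ ℚ-ring

cauchy-if-tail≤null : ∀ {a} (b : ℕ → ℚ) → (∀ n d → ∣ a (d ℕ.+ n) - a n ∣ ≤ b n) →
                      (∀ ε → 0ℚ < ε → Σ ℕ λ K → ∀ n → n ≥ K → b n < ε) → IsCauchy a
cauchy-if-tail≤null {a} b tail≤ b-null ε ε>0 with b-null ε (positive⁻¹ ε {{ε>0}})
... | K , b<ε = K , λ m n m≥K n≥K →
  [ close m n n≥K , (λ m≤n → subst (_< ε) (∣p-q∣≡∣q-p∣ (a n) (a m)) (close n m m≥K m≤n)) ]′ (ℕ.≤-total n m)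
  where
  close : ∀ m n → n ≥ K → n ℕ.≤ m → ∣ a m - a n ∣ < ε
  close m n n≥K n≤m = subst (λ x → ∣ a x - a n ∣ < ε) (ℕ.m∸n+n≡m n≤m) (≤-<-trans (tail≤ n (m ℕ.∸ n)) (b<ε n n≥K))

catalan-cauchy : IsCauchy (partial catalanTerm)
catalan-cauchy = cauchy-if-tail≤null {partial catalanTerm} (λ n → 2 * 1/suc n)
  (∣partial-tail∣≤ (λ k → 2 * 1/suc k) ∣catalanTerm∣≤Δ 2/suc-nonNeg) 2/suc-null
  where
  ∣catalanTerm∣≤Δ : ∀ k → ∣ catalanTerm k ∣ ≤ 2 * 1/suc k - 2 * 1/suc (suc k)
  ∣catalanTerm∣≤Δ k = ≤-trans (≤-reflexive (trans (cong ∣_∣ (catalanTerm≡ k)) (trans (∣sign*∣ k _)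
                        (0≤p⇒∣p∣≡p (square-nonNeg (1/odd-nonNeg 0 k)))))) (1/odd²≤Δ k)
  2/suc-null : ∀ ε → 0ℚ < ε → Σ ℕ λ K → ∀ n → n ≥ K → 2 * 1/suc n < ε
  2/suc-null ε 0<ε = proj₁ small , λ n n≥K → subst (λ c → c * 1/suc n < ε) {fromℕ 2} {2} refl (proj₂ small n n≥K)
    where
    small : Σ ℕ λ K → ∀ n → n ≥ K → fromℕ 2 * 1/suc n < ε
    small = c/suc-eventually< 2 ε 0<ε

*-inv-pos : ∀ ε c → Positive ε → 0ℚ < c → 0ℚ < ε * inv c
*-inv-pos ε c ε>0 0<c = *-pos (positive⁻¹ ε {{ε>0}}) (inv-pos 0<c)

catalan-rhs-close : TendsToZero (λ n → partial catalanTerm n - partial rhsTerm n)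
catalan-rhs-close ε ε>0 = suc K , close
  where
  0<ε : 0ℚ < ε
  0<ε = positive⁻¹ ε {{ε>0}}
  wallis-small : Σ ℕ λ M → wallis M ≤ ε * inv 10
  wallis-small = wallis-eventually≤ (ε * inv 10) (*-inv-pos ε 10 ε>0 (positive⁻¹ 10))
  M = proj₁ wallis-small
  10/suc-small : Σ ℕ λ K → ∀ n → n ≥ K → fromℕ 10 * 1/suc n < ε
  10/suc-small = c/suc-eventually< 10 ε 0<ε
  K = proj₁ 10/suc-small
  close : ∀ n → n ≥ suc K → ∣ partial catalanTerm n - partial rhsTerm n ∣ < ε
  close (suc n) (ℕ.s≤s n≥K) = *-cancelˡ-<-nonNeg 4 (begin-strict
    4 * ∣ partial catalanTerm (suc n) - partial rhsTerm (suc n) ∣   ≤⟨ catalan-rhs-error n M ⟩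
    20 * wallis M + 10 * 1/suc n                                  <⟨ +-mono-≤-< 20w≤2ε (subst (λ c → c * 1/suc n < ε) {fromℕ 10} {10} refl (proj₂ 10/suc-small n n≥K)) ⟩
    2 * ε + ε                                                     ≤⟨ ≤-from-slack ε (<⇒≤ 0<ε) (quadruple ε) ⟩
    4 * ε                                                         ∎)
    where
    open ≤-Reasoning
    20w≤2ε : 20 * wallis M ≤ 2 * ε
    20w≤2ε = ≤-trans (*-monoˡ-≤ 20 (nonNegative⁻¹ 20) (proj₂ wallis-small)) (≤-reflexive (scale ε))
      where
      scale : ∀ ε → 20 * (ε * inv 10) ≡ 2 * ε
      scale = solve-∀ ℚ-ring
    quadruple : ∀ ε → 4 * ε ≡ 2 * ε + ε + ε
    quadruple = solve-∀ ℚ-ring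

cauchy-if-close : ∀ {a b} → IsCauchy a → TendsToZero (λ n → a n - b n) → IsCauchy b
cauchy-if-close {a} {b} a-cauchy a-b→0 ε ε>0
  with a-cauchy (ε * inv 3) (positive (*-inv-pos ε 3 ε>0 (positive⁻¹ 3)))
     | a-b→0 (ε * inv 3) (positive (*-inv-pos ε 3 ε>0 (positive⁻¹ 3)))
... | N₁ , a-close | N₂ , ab-close = N₁ ℕ.⊔ N₂ , close
  where
  close : ∀ m n → m ≥ N₁ ℕ.⊔ N₂ → n ≥ N₁ ℕ.⊔ N₂ → ∣ b m - b n ∣ < ε
  close m n m≥N n≥N = begin-strict
    ∣ b m - b n ∣                                          ≡⟨ cong ∣_∣ (split (a m) (a n) (b m) (b n)) ⟩
    ∣ - (a m - b m) + (a m - a n) + (a n - b n) ∣          ≤⟨ ∣p+q∣≤∣p∣+∣q∣ (- (a m - b m) + (a m - a n)) (a n - b n) ⟩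
    ∣ - (a m - b m) + (a m - a n) ∣ + ∣ a n - b n ∣        ≤⟨ +-monoˡ-≤ ∣ a n - b n ∣ (∣p+q∣≤∣p∣+∣q∣ (- (a m - b m)) (a m - a n)) ⟩
    ∣ - (a m - b m) ∣ + ∣ a m - a n ∣ + ∣ a n - b n ∣      ≡⟨ cong (λ x → x + ∣ a m - a n ∣ + ∣ a n - b n ∣) (∣-p∣≡∣p∣ (a m - b m)) ⟩
    ∣ a m - b m ∣ + ∣ a m - a n ∣ + ∣ a n - b n ∣
      <⟨ +-mono-< (+-mono-< (ab-close m (N₂≤ m≥N)) (a-close m n (N₁≤ m≥N) (N₁≤ n≥N))) (ab-close n (N₂≤ n≥N)) ⟩
    ε * inv 3 + ε * inv 3 + ε * inv 3                      ≡⟨ thirds ε ⟩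
    ε                                                      ∎
    where
    open ≤-Reasoning
    N₁≤ : ∀ {k} → k ≥ N₁ ℕ.⊔ N₂ → k ≥ N₁
    N₁≤ = ℕ.≤-trans (ℕ.m≤m⊔n N₁ N₂)
    N₂≤ : ∀ {k} → k ≥ N₁ ℕ.⊔ N₂ → k ≥ N₂
    N₂≤ = ℕ.≤-trans (ℕ.m≤n⊔m N₁ N₂)
    split : ∀ am an bm bn → bm - bn ≡ - (am - bm) + (am - an) + (an - bn)
    split = solve-∀ ℚ-ring
    thirds : ∀ ε → ε * inv 3 + ε * inv 3 + ε * inv 3 ≡ ε
    thirds = solve-∀ ℚ-ring

theorem1 : ((ε : ℚ) → Positive ε → Σ ℕ λ N → (m n : ℕ) → m ≥ N → n ≥ N →
               ∣ partial catalanTerm m - partial catalanTerm n ∣ < ε)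
             × ((ε : ℚ) → Positive ε → Σ ℕ λ N → (m n : ℕ) → m ≥ N → n ≥ N →
               ∣ partial rhsTerm m - partial rhsTerm n ∣ < ε)
             × ((ε : ℚ) → Positive ε → Σ ℕ λ N → (n : ℕ) → n ≥ N →
               ∣ partial catalanTerm n - partial rhsTerm n ∣ < ε)
theorem1 = catalan-cauchy , cauchy-if-close {partial catalanTerm} {partial rhsTerm} catalan-cauchy catalan-rhs-close ,
           catalan-rhs-close
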